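{- For integers $l\ge2$, $s_1,\dots,s_l\ge1$ and $r_1,\dots,r_l\ge1$, $$ \biggl[\begin{array}{cccc} s_1, & s_2, & \dots, & s_l \\ r_1-1, & r_2-1, & \dots, & r_l-1 \end{array}\biggr] =\sum_{j_2=1}^{r_1+r_2-1}\binom{j_2-1}{r_2-1}\sum_{j_3=1}^{j_2+r_3-1}\binom{j_3-1}{r_3-1}\dotsb\sum_{j_l=1}^{j_{l-1}+r_l-1}\binom{j_l-1}{r_l-1} \,\zeta\biggl[\begin{array}{ccccc} s_1, & s_2, & \dots, & s_{l-1}, & s_l \\ r_1+r_2-j_2, & j_2+r_3-j_3, & \dots, & j_{l-1}+r_l-j_l, & j_l \end{array}\biggr] $$ and $$ \zeta\biggl[\begin{matrix} s_1,\dots,s_l \\ r_1,\dots,r_l \end{matrix}\biggr] =\sum_{i_1=1}^{r_1}\dotsb\sum_{i_{l-1}=1}^{r_{l-1}} (-1)^{r_1+\dots+r_{l-1}-i_1-\dots-i_{l-1}} \binom{r_1-i_1+i_2-1}{r_1-i_1}\dotsb\binom{r_{l-2}-i_{l-2}+i_{l-1}-1}{r_{l-2}-i_{l-2}}\binom{r_{l-1}-i_{l-1}+r_l-1}{r_{l-1}-i_{l-1}} $$ $$ \times\biggl[\begin{array}{ccccc} s_1, & s_2, & \dots, & s_{l-1}, & s_l \\ i_1-1, & r_1-i_1+i_2-1, & \dots, & r_{l-2}-i_{l-2}+i_{l-1}-1, & r_{l-1}-i_{l-1}+r_l-1 \end{array}\biggr]. $$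
   Context: Bi-brackets: for integers $s_j\ge1$, $r_j\ge0$, $\bigl[\begin{smallmatrix} s_1,\dots,s_l \\ r_1,\dots,r_l \end{smallmatrix}\bigr]:=\frac1{r_1!\,(s_1-1)!\dotsb r_l!\,(s_l-1)!}\sum_{n_1>\dots>n_l>0,\ d_1,\dots,d_l>0} n_1^{r_1}d_1^{s_1-1}\dotsb n_l^{r_l}d_l^{s_l-1}q^{n_1d_1+\dots+n_ld_l}$. Multiple $q$-zeta brackets: for integers $s_j\ge1$, $r_j\ge1$, $$ \zeta\biggl[\begin{matrix} s_1,\dots,s_l \\ r_1,\dots,r_l \end{matrix}\biggr] :=\frac{1}{(r_1-1)!\,(s_1-1)!\dotsb(r_l-1)!\,(s_l-1)!}\sum_{\substack{m_1,\dots,m_l>0\\d_1,\dots,d_l>0}} m_1^{r_1-1}d_1^{s_1-1}\dotsb m_l^{r_l-1}d_l^{s_l-1}q^{(m_1+\dots+m_l)d_1+(m_2+\dots+m_l)d_2+\dots+m_ld_l}. $$ -}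

module Defs where

open import Data.Nat as ℕ using (ℕ; zero; suc; _∸_; _!; _≤ᵇ_)
open import Data.Nat.Properties using (_!≢0; m*n≢0)
open import Data.Nat.Combinatorics using (_C_)
open import Data.Integer using (+_)
open import Data.Rational using (ℚ; 0ℚ; 1ℚ; _+_; _*_; -_; _/_)
open import Data.Product using (_×_; _,_)
open import Data.List using (List; []; _∷_; zip)
open import Data.Bool using (if_then_else_)

-- A formal power series in q with rational coefficients, given by its coefficients.
Series : Set
Series = ℕ → ℚ

⟦_⟧ : ℕ → ℚ
⟦ n ⟧ = (+ n) / 1

_/!_!_ : ℕ → ℕ → ℕ → ℚ
a /! b ! c = (+ a) / (b ! ℕ.* c !)
  where instance _ = m*n≢0 (b !) (c !) {{b !≢0}} {{c !≢0}}

Σ[1…_] : ℕ → (ℕ → ℚ) → ℚ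
Σ[1… zero ] f = 0ℚ
Σ[1… suc n ] f = Σ[1… n ] f + f (suc n)

sgn : ℕ → ℚ
sgn zero = 1ℚ
sgn (suc k) = - sgn k

-- Columns are pairs (s , r).
-- biAux cols m N = Σ over n_1 > ... > n_l > 0 with n_1 < m, d_j > 0,
--   n_1 d_1 + ... + n_l d_l = N, of Π n_j^{r_j} d_j^{s_j-1} / (r_j! (s_j-1)!).
-- (Restricting to n, d ≤ N loses nothing, as n d ≤ N with n, d ≥ 1.)
biAux : List (ℕ × ℕ) → ℕ → ℕ → ℚ
biAux [] m N = if N ≤ᵇ 0 then 1ℚ else 0ℚ
biAux ((s , r) ∷ cols) m N =
  Σ[1… m ∸ 1 ] λ n → Σ[1… N ] λ d →
    if n ℕ.* d ≤ᵇ N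
    then ((n ℕ.^ r ℕ.* d ℕ.^ (s ∸ 1)) /! r ! (s ∸ 1)) * biAux cols n (N ∸ n ℕ.* d)
    else 0ℚ

-- coefficient of q^N of the bi-bracket [ s_1 … s_l ; r_1 … r_l ]
biBracket : List (ℕ × ℕ) → Series
biBracket cols N = biAux cols (suc N) N

-- Multiple q-zeta brackets.  The exponent
--   (m_1+…+m_l) d_1 + (m_2+…+m_l) d_2 + … + m_l d_l = Σ_j m_j (d_1+…+d_j).
-- zAux cols D N: D = d_1 + … + d_{j-1} already chosen, N = remaining exponent.
zAux : List (ℕ × ℕ) → ℕ → ℕ → ℚ
zAux [] D N = if N ≤ᵇ 0 then 1ℚ else 0ℚ
zAux ((s , r) ∷ cols) D N =
  Σ[1… N ] λ d → Σ[1… N ] λ m →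
    if m ℕ.* (D ℕ.+ d) ≤ᵇ N
    then ((m ℕ.^ (r ∸ 1) ℕ.* d ℕ.^ (s ∸ 1)) /! (r ∸ 1) ! (s ∸ 1))
           * zAux cols (D ℕ.+ d) (N ∸ m ℕ.* (D ℕ.+ d))
    else 0ℚ

-- coefficient of q^N of ζ[ s_1 … s_l ; r_1 … r_l ]
zetaBracket : List (ℕ × ℕ) → Series
zetaBracket cols N = zAux cols 0 N

-- T c (r_k ∷ … ∷ r_l) k  with carry c (= r_1, resp. j_{k-1}):
--   Σ_{j=1}^{c+r_k-1} C(j-1, r_k-1) · (bottom entry c + r_k - j) · …,
-- last bottom entry j_l.  k receives the bottom row.
T : ℕ → List ℕ → (List ℕ → ℚ) → ℚ
T c [] k = k (c ∷ [])
T c (r ∷ rs) k =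
  Σ[1… c ℕ.+ r ∸ 1 ] λ j →
    ⟦ (j ∸ 1) C (r ∸ 1) ⟧ * T j rs (λ b → k ((c ℕ.+ r ∸ j) ∷ b))

-- RHS of the first identity (top row s, parameters r_1 … r_l; l ≥ 2)
rhs1 : List ℕ → List ℕ → Series
rhs1 s [] N = 0ℚ
rhs1 s (r₁ ∷ rs) N = T r₁ rs (λ b → zetaBracket (zip s b) N)

-- U p (r_k ∷ … ∷ r_l) k  with carry p = r_{k-1} - i_{k-1}:
--   for k < l: Σ_{i=1}^{r_k} (-1)^{r_k - i} C(p+i-1, p) · (bottom entry p+i-1) · …
--   for k = l: C(p + r_l - 1, p) · (bottom entry p + r_l - 1).
U : ℕ → List ℕ → (List ℕ → ℚ) → ℚ
U p [] k = 0ℚ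
U p (r ∷ []) k = ⟦ (p ℕ.+ r ∸ 1) C p ⟧ * k ((p ℕ.+ r ∸ 1) ∷ [])
U p (r ∷ rs@(_ ∷ _)) k =
  Σ[1… r ] λ i →
    (sgn (r ∸ i) * ⟦ (p ℕ.+ i ∸ 1) C p ⟧) * U (r ∸ i) rs (λ b → k ((p ℕ.+ i ∸ 1) ∷ b))

-- RHS of the second identity: the outermost sum over i_1 has no binomial,
-- and the first bottom entry is i_1 - 1.
rhs2 : List ℕ → List ℕ → Series
rhs2 s [] N = 0ℚ
rhs2 s (r₁ ∷ rs) N =
  Σ[1… r₁ ] λ i₁ → sgn (r₁ ∸ i₁) * U (r₁ ∸ i₁) rs (λ b → biBracket (zip s ((i₁ ∸ 1) ∷ b)) N)

module Submission where

-- Both brackets are nested finite sums whose summands are products, one per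
-- column, of divided powers x^k/k! (`dpow`): n^r/r! (resp. m^(r-1)/(r-1)!)
-- times d^(s-1)/(s-1)!.  For an arbitrary weight,
--    substituting n_j = m_j + … + m_l turns the summation over
--    n₁ > … > n_l > 0 with exponent Σ n_j d_j into free summation over m_j > 0
--    with exponent Σ_j m_j (d₁ + … + d_j), the shape of a q-zeta bracket.  For fixed m and d the
--    summands of both identities agree; column by column this is the binomial
--    theorem for divided powers (`dpow-+`, from the library's binomial
--    theorem) in the two forms `expand-sum` and `expand-difference`.
--  * Linearity.  T and U commute with the nested sums (`T-zetaSum`,
--    `U-zetaSum`), so the pointwise identities can be summed.

open import Defs
open import Data.Nat using (ℕ; _≤_; _∸_)
open import Data.Vec using (Vec; toList; zip; map)
open import Data.Vec.Relation.Unary.All using (All)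
open import Data.Product using (_×_)
open import Relation.Binary.PropositionalEquality using (_≡_)

open import Data.Bool using (true; false; if_then_else_)
open import Data.Empty using (⊥-elim)
open import Data.Unit using (tt)
open import Data.Product using (_,_)
open import Data.Fin using (toℕ)
open import Data.Nat as ℕ using (zero; suc; _!; NonZero; _<_; z≤n; s≤s; _≤ᵇ_; _≤′_; ≤′-refl; ≤′-step)
import Data.Nat.Properties as ℕP
open import Data.Nat.Combinatorics using (_C_; nCk≡n!/k![n-k]!; k![n∸k]!∣n!; k>n⇒nCk≡0)
open import Data.Nat.DivMod using (m/n*n≡m)
import Data.Integer as ℤ
import Data.Integer.Properties as ℤP
open import Data.Rational using (ℚ; 0ℚ; 1ℚ; _+_; _*_; -_; _/_; fromℚᵘ)
import Data.Rational.Properties as ℚP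
open import Data.Rational.Unnormalised as ℚᵘ using (mkℚᵘ)
import Data.Rational.Unnormalised.Properties as ℚᵘP
open import Data.Rational.Solver using (module +-*-Solver)
open +-*-Solver using (solve; _:+_; _:*_; :-_; _:=_; con)
open import Data.List as L using (List; []; _∷_; length)
import Data.List.Properties as LP
import Data.List.Relation.Unary.All as LA
import Data.Vec as V
import Data.Vec.Properties as VP
import Data.Vec.Relation.Unary.All.Properties as VAP
open import Relation.Nullary using (yes; no)
open import Relation.Binary.PropositionalEquality using (refl; sym; trans; cong; cong₂; subst; module ≡-Reasoning)

open import Algebra.Bundles using (CommutativeRing)
open CommutativeRing ℚP.+-*-commutativeRing using (semiring; commutativeSemiring; +-monoid)
open import Algebra.Properties.Semiring.Exp semiring using (_^_; ^-homo-*)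
open import Algebra.Properties.Semiring.Mult semiring using () renaming (_×_ to _·_)
open import Algebra.Properties.Monoid.Sum +-monoid using (sum)
import Algebra.Properties.CommutativeSemiring.Binomial commutativeSemiring as Binomial

Σ-cong : ∀ n {f g : ℕ → ℚ} → (∀ i → 1 ≤ i → i ≤ n → f i ≡ g i) → Σ[1… n ] f ≡ Σ[1… n ] g
Σ-cong zero h = refl
Σ-cong (suc n) h = cong₂ _+_ (Σ-cong n (λ i p q → h i p (ℕP.m≤n⇒m≤1+n q))) (h (suc n) (s≤s z≤n) ℕP.≤-refl)

Σ-vanish : ∀ n {f : ℕ → ℚ} → (∀ i → 1 ≤ i → i ≤ n → f i ≡ 0ℚ) → Σ[1… n ] f ≡ 0ℚ
Σ-vanish zero h = refl
Σ-vanish (suc n) h = trans (cong₂ _+_ (Σ-vanish n (λ i p q → h i p (ℕP.m≤n⇒m≤1+n q))) (h (suc n) (s≤s z≤n) ℕP.≤-refl)) (ℚP.+-identityʳ 0ℚ)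

Σ-+ : ∀ n (f g : ℕ → ℚ) → Σ[1… n ] (λ i → f i + g i) ≡ Σ[1… n ] f + Σ[1… n ] g
Σ-+ zero f g = sym (ℚP.+-identityʳ 0ℚ)
Σ-+ (suc n) f g = begin
    Σ[1… n ] (λ i → f i + g i) + (f (suc n) + g (suc n))
      ≡⟨ cong (_+ (f (suc n) + g (suc n))) (Σ-+ n f g) ⟩
    (Σ[1… n ] f + Σ[1… n ] g) + (f (suc n) + g (suc n))
      ≡⟨ solve 4 (λ a b c d → (a :+ b) :+ (c :+ d) := (a :+ c) :+ (b :+ d)) refl (Σ[1… n ] f) (Σ[1… n ] g) (f (suc n)) (g (suc n)) ⟩
    (Σ[1… n ] f + f (suc n)) + (Σ[1… n ] g + g (suc n)) ∎
  where open ≡-Reasoning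

Σ-*ˡ : ∀ n (c : ℚ) (f : ℕ → ℚ) → Σ[1… n ] (λ i → c * f i) ≡ c * Σ[1… n ] f
Σ-*ˡ zero c f = sym (ℚP.*-zeroʳ c)
Σ-*ˡ (suc n) c f = trans (cong (_+ c * f (suc n)) (Σ-*ˡ n c f)) (sym (ℚP.*-distribˡ-+ c _ _))

Σ-*ʳ : ∀ n (c : ℚ) (f : ℕ → ℚ) → Σ[1… n ] (λ i → f i * c) ≡ Σ[1… n ] f * c
Σ-*ʳ n c f = trans (Σ-cong n (λ i _ _ → ℚP.*-comm (f i) c)) (trans (Σ-*ˡ n c f) (ℚP.*-comm c _))

Σ-swap : ∀ a b (f : ℕ → ℕ → ℚ) → Σ[1… a ] (λ i → Σ[1… b ] (λ j → f i j)) ≡ Σ[1… b ] (λ j → Σ[1… a ] (λ i → f i j))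
Σ-swap zero b f = sym (Σ-vanish b (λ _ _ _ → refl))
Σ-swap (suc a) b f = trans (cong (_+ Σ[1… b ] (f (suc a))) (Σ-swap a b f)) (sym (Σ-+ b _ _))

Σ-pad : ∀ {n m} {f : ℕ → ℚ} → n ≤ m → (∀ i → n < i → i ≤ m → f i ≡ 0ℚ) → Σ[1… n ] f ≡ Σ[1… m ] f
Σ-pad n≤m = go (ℕP.≤⇒≤′ n≤m)
  where
  go : ∀ {n m} {f : ℕ → ℚ} → n ≤′ m → (∀ i → n < i → i ≤ m → f i ≡ 0ℚ) → Σ[1… n ] f ≡ Σ[1… m ] f
  go ≤′-refl z = refl
  go {n} {suc m} {f} (≤′-step n≤′m) z = begin
      Σ[1… n ] f             ≡⟨ go n≤′m (λ i p q → z i p (ℕP.m≤n⇒m≤1+n q)) ⟩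
      Σ[1… m ] f             ≡⟨ sym (ℚP.+-identityʳ _) ⟩
      Σ[1… m ] f + 0ℚ        ≡⟨ cong (Σ[1… m ] f +_) (sym (z (suc m) (s≤s (ℕP.≤′⇒≤ n≤′m)) ℕP.≤-refl)) ⟩
      Σ[1… m ] f + f (suc m) ∎
    where open ≡-Reasoning

Σ-split : ∀ a k (f : ℕ → ℚ) → Σ[1… a ℕ.+ k ] f ≡ Σ[1… a ] f + Σ[1… k ] (λ u → f (a ℕ.+ u))
Σ-split a zero f = trans (cong (λ z → Σ[1… z ] f) (ℕP.+-identityʳ a)) (sym (ℚP.+-identityʳ _))
Σ-split a (suc k) f = begin
    Σ[1… a ℕ.+ suc k ] f
      ≡⟨ cong (λ z → Σ[1… z ] f) (ℕP.+-suc a k) ⟩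
    Σ[1… a ℕ.+ k ] f + f (suc (a ℕ.+ k))
      ≡⟨ cong₂ _+_ (Σ-split a k f) (cong f (sym (ℕP.+-suc a k))) ⟩
    (Σ[1… a ] f + Σ[1… k ] (λ u → f (a ℕ.+ u))) + f (a ℕ.+ suc k)
      ≡⟨ ℚP.+-assoc (Σ[1… a ] f) (Σ[1… k ] (λ u → f (a ℕ.+ u))) (f (a ℕ.+ suc k)) ⟩
    Σ[1… a ] f + Σ[1… suc k ] (λ u → f (a ℕ.+ u)) ∎
  where open ≡-Reasoning

Σ-triangle : ∀ K (H : ℕ → ℕ → ℚ) →
  Σ[1… K ] (λ n₁ → Σ[1… n₁ ∸ 1 ] (H n₁)) ≡ Σ[1… K ] (λ n₂ → Σ[1… K ∸ n₂ ] (λ m → H (m ℕ.+ n₂) n₂))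
Σ-triangle zero H = refl
Σ-triangle (suc K) H = begin
    Σ[1… K ] (λ n₁ → Σ[1… n₁ ∸ 1 ] (H n₁)) + Σ[1… K ] (H (suc K))
      ≡⟨ cong (_+ Σ[1… K ] (H (suc K))) (Σ-triangle K H) ⟩
    Σ[1… K ] (λ n₂ → Σ[1… K ∸ n₂ ] (λ m → H (m ℕ.+ n₂) n₂)) + Σ[1… K ] (H (suc K))
      ≡⟨ sym (Σ-+ K _ _) ⟩
    Σ[1… K ] (λ n₂ → Σ[1… K ∸ n₂ ] (λ m → H (m ℕ.+ n₂) n₂) + H (suc K) n₂)
      ≡⟨ Σ-cong K (λ n₂ _ n₂≤K →
           cong (λ z → Σ[1… K ∸ n₂ ] (λ m → H (m ℕ.+ n₂) n₂) + H (suc z) n₂) (sym (ℕP.m∸n+n≡m n₂≤K))) ⟩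
    Σ[1… K ] (λ n₂ → Σ[1… suc (K ∸ n₂) ] (λ m → H (m ℕ.+ n₂) n₂))
      ≡⟨ Σ-cong K (λ n₂ _ n₂≤K → cong (λ z → Σ[1… z ] (λ m → H (m ℕ.+ n₂) n₂)) (sym (ℕP.+-∸-assoc 1 n₂≤K))) ⟩
    Σ[1… K ] (λ n₂ → Σ[1… suc K ∸ n₂ ] (λ m → H (m ℕ.+ n₂) n₂))
      ≡⟨ sym (ℚP.+-identityʳ _) ⟩
    Σ[1… K ] (λ n₂ → Σ[1… suc K ∸ n₂ ] (λ m → H (m ℕ.+ n₂) n₂)) + 0ℚ
      ≡⟨ cong (λ z → Σ[1… K ] (λ n₂ → Σ[1… suc K ∸ n₂ ] (λ m → H (m ℕ.+ n₂) n₂)) + Σ[1… z ] (λ m → H (m ℕ.+ suc K) (suc K)))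
              (sym (ℕP.n∸n≡0 K)) ⟩
    Σ[1… suc K ] (λ n₂ → Σ[1… suc K ∸ n₂ ] (λ m → H (m ℕ.+ n₂) n₂)) ∎
  where open ≡-Reasoning

-- Guarded terms: the defining sums keep a term only while the exponent
-- used so far, x, does not exceed N.
guard : ℕ → ℕ → ℚ → ℚ
guard x N q = if x ≤ᵇ N then q else 0ℚ

guard-≤ : ∀ {x N q} → x ≤ N → guard x N q ≡ q
guard-≤ {x} {N} x≤N with x ≤ᵇ N | ℕP.≤⇒≤ᵇ x≤N
... | true | _ = refl

guard-> : ∀ {x N q} → N < x → guard x N q ≡ 0ℚ
guard-> {x} {N} N<x with x ≤ᵇ N | ℕP.≤ᵇ⇒≤ x N
... | false | _ = refl
... | true | x≤N = ⊥-elim (ℕP.<⇒≱ N<x (x≤N tt))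

guard-* : ∀ x N c q → guard x N (c * q) ≡ c * guard x N q
guard-* x N c q with x ≤ᵇ N
... | true = refl
... | false = sym (ℚP.*-zeroʳ c)

guard-+ : ∀ x N q q' → guard x N q + guard x N q' ≡ guard x N (q + q')
guard-+ x N q q' with x ≤ᵇ N
... | true = refl
... | false = ℚP.+-identityʳ 0ℚ

guard-0 : ∀ x N → guard x N 0ℚ ≡ 0ℚ
guard-0 x N with x ≤ᵇ N
... | true = refl
... | false = refl

guard-shift : ∀ a x N {q} → a ≤ N → guard x (N ∸ a) q ≡ guard (a ℕ.+ x) N q
guard-shift a x N a≤N with x ℕ.≤? N ∸ a
... | yes x≤ = trans (guard-≤ x≤) (sym (guard-≤ (subst (a ℕ.+ x ≤_) (ℕP.m+[n∸m]≡n a≤N) (ℕP.+-monoʳ-≤ a x≤))))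
... | no x≰ = trans (guard-> (ℕP.≰⇒> x≰)) (sym (guard-> (subst (_< a ℕ.+ x) (ℕP.m+[n∸m]≡n a≤N) (ℕP.+-monoʳ-< a (ℕP.≰⇒> x≰)))))

-- A guarded sum over the remainder N ∸ a, with summation variable d
-- entering the exponent through n * B d ≥ d, equals the sum up to N
-- guarded by the total exponent: the extra terms all fail the guard.
guarded-sum-shift : ∀ a N n (B : ℕ → ℕ) (F : ℕ → ℕ → ℚ) → a ≤ N → (∀ d → d ≤ B d) → 1 ≤ n →
  Σ[1… N ∸ a ] (λ d → guard (n ℕ.* B d) (N ∸ a) (F d ((N ∸ a) ∸ n ℕ.* B d)))
  ≡ Σ[1… N ] (λ d → guard (a ℕ.+ n ℕ.* B d) N (F d (N ∸ (a ℕ.+ n ℕ.* B d))))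
guarded-sum-shift a N n B F a≤N d≤Bd 1≤n = trans (Σ-cong (N ∸ a) same) (Σ-pad (ℕP.m∸n≤m N a) beyond)
  where
  same : ∀ d → 1 ≤ d → d ≤ N ∸ a →
    guard (n ℕ.* B d) (N ∸ a) (F d ((N ∸ a) ∸ n ℕ.* B d)) ≡ guard (a ℕ.+ n ℕ.* B d) N (F d (N ∸ (a ℕ.+ n ℕ.* B d)))
  same d _ _ = trans (cong (λ R → guard (n ℕ.* B d) (N ∸ a) (F d R)) (ℕP.∸-+-assoc N a (n ℕ.* B d)))
                     (guard-shift a (n ℕ.* B d) N a≤N)
  beyond : ∀ d → N ∸ a < d → d ≤ N → guard (a ℕ.+ n ℕ.* B d) N (F d (N ∸ (a ℕ.+ n ℕ.* B d))) ≡ 0ℚ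
  beyond d N∸a<d _ = guard-> (subst (_< a ℕ.+ n ℕ.* B d) (ℕP.m+[n∸m]≡n a≤N)
    (ℕP.+-monoʳ-< a (ℕP.<-≤-trans N∸a<d (ℕP.≤-trans (d≤Bd d) (ℕP.m≤n*m (B d) n {{ℕ.>-nonZero 1≤n}})))))

-- Generic nested sums.  A weight assigns a value to the lists of summation
-- variables (n₁ … n_l or m₁ … m_l) and (d₁ … d_l).
Weight : Set
Weight = List ℕ → List ℕ → ℚ

-- biSum l W D b N: the sum of W n d over b > n₁ > … > n_l > 0 and d_j ≥ 1
-- with n₁ (D + d₁) + n₂ d₂ + … + n_l d_l = N, the shape of a bi-bracket.
biSum : ℕ → Weight → ℕ → ℕ → ℕ → ℚ
biSum zero W D b N = guard N 0 (W [] [])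
biSum (suc l) W D b N = Σ[1… b ∸ 1 ] λ n → Σ[1… N ] λ d →
  guard (n ℕ.* (D ℕ.+ d)) N (biSum l (λ ns ds → W (n ∷ ns) (d ∷ ds)) 0 n (N ∸ n ℕ.* (D ℕ.+ d)))

-- zetaSum l W D N: the sum of W m d over m_j, d_j ≥ 1 with
-- Σ_j m_j (D + d₁ + … + d_j) = N, the shape of a q-zeta bracket.
zetaSum : ℕ → Weight → ℕ → ℕ → ℚ
zetaSum zero W D N = guard N 0 (W [] [])
zetaSum (suc l) W D N = Σ[1… N ] λ d → Σ[1… N ] λ m →
  guard (m ℕ.* (D ℕ.+ d)) N (zetaSum l (λ ms ds → W (m ∷ ms) (d ∷ ds)) (D ℕ.+ d) (N ∸ m ℕ.* (D ℕ.+ d)))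

head₀ : List ℕ → ℕ
head₀ [] = 0
head₀ (x ∷ _) = x

tail₀ : List ℕ → List ℕ
tail₀ [] = []
tail₀ (_ ∷ xs) = xs

suffixSums : List ℕ → List ℕ
suffixSums [] = []
suffixSums (m ∷ ms) = (m ℕ.+ head₀ (suffixSums ms)) ∷ suffixSums ms

-- One level of the change of variables n₁ = m₁ + n₂ for the two outermost
-- summation levels, with the deeper levels abstracted into G n₁ d₁ n₂ d₂ R
-- (R the exponent still to be reached).  Both sides are brought to a common
-- normal form: a sum over d₁, n₂, m₁, d₂ ≤ N guarded by the total exponent
-- m₁ A + n₂ (A + d₂), where A = D + d₁.
module LevelShift (N D : ℕ) (G : ℕ → ℕ → ℕ → ℕ → ℕ → ℚ) where

  A : ℕ → ℕ
  A d₁ = D ℕ.+ d₁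

  1≤A : ∀ d₁ → 1 ≤ d₁ → 1 ≤ A d₁
  1≤A d₁ 1≤d₁ = ℕP.≤-trans 1≤d₁ (ℕP.m≤n+m d₁ D)

  R₁ : ℕ → ℕ → ℕ
  R₁ n₁ d₁ = N ∸ n₁ ℕ.* A d₁

  biLevel : ℕ → ℕ → ℚ
  biLevel d₁ n₁ = guard (n₁ ℕ.* A d₁) N (Σ[1… n₁ ∸ 1 ] λ n₂ → Σ[1… R₁ n₁ d₁ ] λ d₂ →
    guard (n₂ ℕ.* d₂) (R₁ n₁ d₁) (G n₁ d₁ n₂ d₂ (R₁ n₁ d₁ ∸ n₂ ℕ.* d₂)))

  -- The two outermost levels of a q-zeta-shaped sum, for fixed m₁, d₁,
  -- with n₁ = m₁ + n₂ passed on to G.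
  zetaLevel : ℕ → ℕ → ℚ
  zetaLevel d₁ m₁ = guard (m₁ ℕ.* A d₁) N (Σ[1… R₁ m₁ d₁ ] λ n₂ → Σ[1… R₁ m₁ d₁ ] λ d₂ →
    guard (n₂ ℕ.* (A d₁ ℕ.+ d₂)) (R₁ m₁ d₁) (G (m₁ ℕ.+ n₂) d₁ n₂ d₂ (R₁ m₁ d₁ ∸ n₂ ℕ.* (A d₁ ℕ.+ d₂))))

  inner : ℕ → ℕ → ℕ → ℚ
  inner d₁ n₁ n₂ = Σ[1… N ] λ d₂ →
    guard (n₁ ℕ.* A d₁ ℕ.+ n₂ ℕ.* d₂) N (G n₁ d₁ n₂ d₂ (N ∸ (n₁ ℕ.* A d₁ ℕ.+ n₂ ℕ.* d₂)))

  normal : ℕ → ℕ → ℕ → ℕ → ℚ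
  normal d₁ n₂ m₁ d₂ = guard (m₁ ℕ.* A d₁ ℕ.+ n₂ ℕ.* (A d₁ ℕ.+ d₂)) N
    (G (m₁ ℕ.+ n₂) d₁ n₂ d₂ (N ∸ (m₁ ℕ.* A d₁ ℕ.+ n₂ ℕ.* (A d₁ ℕ.+ d₂))))

  -- The bi-bracket side: the outer guard is absorbed into the inner ones.
  lhs-absorb : ∀ d₁ n₁ → biLevel d₁ n₁ ≡ Σ[1… n₁ ∸ 1 ] (inner d₁ n₁)
  lhs-absorb d₁ n₁ with n₁ ℕ.* A d₁ ℕ.≤? N
  ... | yes fits = trans (guard-≤ fits) (Σ-cong (n₁ ∸ 1) (λ n₂ 1≤n₂ _ →
        guarded-sum-shift (n₁ ℕ.* A d₁) N n₂ (λ d₂ → d₂) (λ d₂ R → G n₁ d₁ n₂ d₂ R) fits (λ _ → ℕP.≤-refl) 1≤n₂))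
  ... | no too-big = trans (guard-> (ℕP.≰⇒> too-big)) (sym (Σ-vanish (n₁ ∸ 1) (λ n₂ _ _ → Σ-vanish N (λ d₂ _ _ →
        guard-> (ℕP.<-≤-trans (ℕP.≰⇒> too-big) (ℕP.m≤m+n _ _))))))

  exponent-shift : ∀ m₁ n₂ a d₂ → (m₁ ℕ.+ n₂) ℕ.* a ℕ.+ n₂ ℕ.* d₂ ≡ m₁ ℕ.* a ℕ.+ n₂ ℕ.* (a ℕ.+ d₂)
  exponent-shift m₁ n₂ a d₂ = begin
      (m₁ ℕ.+ n₂) ℕ.* a ℕ.+ n₂ ℕ.* d₂       ≡⟨ cong (ℕ._+ n₂ ℕ.* d₂) (ℕP.*-distribʳ-+ a m₁ n₂) ⟩
      (m₁ ℕ.* a ℕ.+ n₂ ℕ.* a) ℕ.+ n₂ ℕ.* d₂ ≡⟨ ℕP.+-assoc (m₁ ℕ.* a) (n₂ ℕ.* a) (n₂ ℕ.* d₂) ⟩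
      m₁ ℕ.* a ℕ.+ (n₂ ℕ.* a ℕ.+ n₂ ℕ.* d₂) ≡⟨ cong (m₁ ℕ.* a ℕ.+_) (sym (ℕP.*-distribˡ-+ n₂ a d₂)) ⟩
      m₁ ℕ.* a ℕ.+ n₂ ℕ.* (a ℕ.+ d₂)       ∎
    where open ≡-Reasoning

  inner-beyond : ∀ d₁ n₂ m₁ → 1 ≤ d₁ → n₂ ≤ N → N ∸ n₂ < m₁ → inner d₁ (m₁ ℕ.+ n₂) n₂ ≡ 0ℚ
  inner-beyond d₁ n₂ m₁ 1≤d₁ n₂≤N N∸n₂<m₁ = Σ-vanish N (λ d₂ _ _ →
      guard-> (ℕP.<-≤-trans N<n₁ (ℕP.≤-trans (ℕP.m≤m*n (m₁ ℕ.+ n₂) (A d₁) {{ℕ.>-nonZero (1≤A d₁ 1≤d₁)}}) (ℕP.m≤m+n _ _))))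
    where
    N<n₁ : N < m₁ ℕ.+ n₂
    N<n₁ = subst (_< m₁ ℕ.+ n₂) (ℕP.m∸n+n≡m n₂≤N) (ℕP.+-monoˡ-< n₂ N∸n₂<m₁)

  -- The bi-bracket side in normal form: triangle reindexing n₁ = m₁ + n₂.
  lhs-normal : ∀ d₁ → 1 ≤ d₁ →
    Σ[1… N ] (biLevel d₁) ≡ Σ[1… N ] (λ n₂ → Σ[1… N ] (λ m₁ → Σ[1… N ] (normal d₁ n₂ m₁)))
  lhs-normal d₁ 1≤d₁ = begin
      Σ[1… N ] (biLevel d₁)
        ≡⟨ Σ-cong N (λ n₁ _ _ → lhs-absorb d₁ n₁) ⟩
      Σ[1… N ] (λ n₁ → Σ[1… n₁ ∸ 1 ] (inner d₁ n₁))
        ≡⟨ Σ-triangle N (inner d₁) ⟩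
      Σ[1… N ] (λ n₂ → Σ[1… N ∸ n₂ ] (λ m₁ → inner d₁ (m₁ ℕ.+ n₂) n₂))
        ≡⟨ Σ-cong N (λ n₂ _ n₂≤N → Σ-pad (ℕP.m∸n≤m N n₂) (λ m₁ p _ → inner-beyond d₁ n₂ m₁ 1≤d₁ n₂≤N p)) ⟩
      Σ[1… N ] (λ n₂ → Σ[1… N ] (λ m₁ → inner d₁ (m₁ ℕ.+ n₂) n₂))
        ≡⟨ Σ-cong N (λ n₂ _ _ → Σ-cong N (λ m₁ _ _ → Σ-cong N (λ d₂ _ _ →
             cong (λ x → guard x N (G (m₁ ℕ.+ n₂) d₁ n₂ d₂ (N ∸ x))) (exponent-shift m₁ n₂ (A d₁) d₂)))) ⟩
      Σ[1… N ] (λ n₂ → Σ[1… N ] (λ m₁ → Σ[1… N ] (normal d₁ n₂ m₁))) ∎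
    where open ≡-Reasoning

  -- The q-zeta side in normal form: the outer guard is absorbed and the
  -- range of n₂ is extended to N.
  rhs-normal : ∀ d₁ m₁ → 1 ≤ d₁ → zetaLevel d₁ m₁ ≡ Σ[1… N ] (λ n₂ → Σ[1… N ] (normal d₁ n₂ m₁))
  rhs-normal d₁ m₁ 1≤d₁ with m₁ ℕ.* A d₁ ℕ.≤? N
  ... | yes fits = trans (guard-≤ fits) (trans
        (Σ-cong (N ∸ m₁ ℕ.* A d₁) (λ n₂ 1≤n₂ _ →
           guarded-sum-shift (m₁ ℕ.* A d₁) N n₂ (A d₁ ℕ.+_) (λ d₂ R → G (m₁ ℕ.+ n₂) d₁ n₂ d₂ R) fits (λ d₂ → ℕP.m≤n+m d₂ (A d₁)) 1≤n₂))
        (Σ-pad (ℕP.m∸n≤m N (m₁ ℕ.* A d₁)) (λ n₂ N∸a<n₂ _ → Σ-vanish N (λ d₂ 1≤d₂ _ →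
           guard-> (subst (_< m₁ ℕ.* A d₁ ℕ.+ n₂ ℕ.* (A d₁ ℕ.+ d₂)) (ℕP.m+[n∸m]≡n fits)
             (ℕP.+-monoʳ-< (m₁ ℕ.* A d₁) (ℕP.<-≤-trans N∸a<n₂
               (ℕP.m≤m*n n₂ (A d₁ ℕ.+ d₂) {{ℕ.>-nonZero (ℕP.≤-trans 1≤d₂ (ℕP.m≤n+m d₂ (A d₁)))}}))))))))
  ... | no too-big = trans (guard-> (ℕP.≰⇒> too-big)) (sym (Σ-vanish N (λ n₂ _ _ → Σ-vanish N (λ d₂ _ _ →
        guard-> (ℕP.<-≤-trans (ℕP.≰⇒> too-big) (ℕP.m≤m+n _ _))))))

  level-shift : Σ[1… N ] (λ n₁ → Σ[1… N ] (λ d₁ → biLevel d₁ n₁)) ≡ Σ[1… N ] (λ d₁ → Σ[1… N ] (zetaLevel d₁))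
  level-shift = begin
      Σ[1… N ] (λ n₁ → Σ[1… N ] (λ d₁ → biLevel d₁ n₁))
        ≡⟨ Σ-swap N N _ ⟩
      Σ[1… N ] (λ d₁ → Σ[1… N ] (biLevel d₁))
        ≡⟨ Σ-cong N (λ d₁ 1≤d₁ _ → lhs-normal d₁ 1≤d₁) ⟩
      Σ[1… N ] (λ d₁ → Σ[1… N ] (λ n₂ → Σ[1… N ] (λ m₁ → Σ[1… N ] (normal d₁ n₂ m₁))))
        ≡⟨ Σ-cong N (λ d₁ _ _ → Σ-swap N N _) ⟩
      Σ[1… N ] (λ d₁ → Σ[1… N ] (λ m₁ → Σ[1… N ] (λ n₂ → Σ[1… N ] (normal d₁ n₂ m₁))))
        ≡⟨ sym (Σ-cong N (λ d₁ 1≤d₁ _ → Σ-cong N (λ m₁ _ _ → rhs-normal d₁ m₁ 1≤d₁))) ⟩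
      Σ[1… N ] (λ d₁ → Σ[1… N ] (zetaLevel d₁)) ∎
    where open ≡-Reasoning

-- Peeling the outermost level of a bi-bracket-shaped sum: n₁ becomes
-- m₁ + n₂ and d₁ joins the offset D of the next level.
biSum-peel : ∀ l W D N → biSum (suc l) W D (suc N) N ≡
  Σ[1… N ] (λ d → Σ[1… N ] (λ m → guard (m ℕ.* (D ℕ.+ d)) N
    (biSum l (λ ns ds → W ((m ℕ.+ head₀ ns) ∷ ns) (d ∷ ds)) (D ℕ.+ d) (suc (N ∸ m ℕ.* (D ℕ.+ d))) (N ∸ m ℕ.* (D ℕ.+ d)))))
biSum-peel zero W D N = trans (Σ-swap N N _) (Σ-cong N (λ d _ _ → Σ-cong N (λ m _ _ →
  cong (λ n → guard (m ℕ.* (D ℕ.+ d)) N (guard (N ∸ m ℕ.* (D ℕ.+ d)) 0 (W (n ∷ []) (d ∷ [])))) (sym (ℕP.+-identityʳ m)))))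
biSum-peel (suc l) W D N =
  LevelShift.level-shift N D (λ n₁ d₁ n₂ d₂ R → biSum l (λ ns ds → W (n₁ ∷ n₂ ∷ ns) (d₁ ∷ d₂ ∷ ds)) 0 n₂ R)

change-of-variables : ∀ l W D N → biSum l W D (suc N) N ≡ zetaSum l (λ ms ds → W (suffixSums ms) ds) D N
change-of-variables zero W D N = refl
change-of-variables (suc l) W D N = trans (biSum-peel l W D N) (Σ-cong N (λ d _ _ → Σ-cong N (λ m _ _ →
  cong (guard (m ℕ.* (D ℕ.+ d)) N)
    (change-of-variables l (λ ns ds → W ((m ℕ.+ head₀ ns) ∷ ns) (d ∷ ds)) (D ℕ.+ d) (N ∸ m ℕ.* (D ℕ.+ d))))))

zetaSum-* : ∀ l c W D N → zetaSum l (λ ms ds → c * W ms ds) D N ≡ c * zetaSum l W D N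
zetaSum-* zero c W D N = guard-* N 0 c (W [] [])
zetaSum-* (suc l) c W D N = trans
  (Σ-cong N (λ d _ _ → Σ-cong N (λ m _ _ → let R = N ∸ m ℕ.* (D ℕ.+ d) in
    trans (cong (guard (m ℕ.* (D ℕ.+ d)) N) (zetaSum-* l c _ (D ℕ.+ d) R)) (guard-* (m ℕ.* (D ℕ.+ d)) N c _))))
  (trans (Σ-cong N (λ d _ _ → Σ-*ˡ N c _)) (Σ-*ˡ N c _))

zetaSum-+ : ∀ l W W' D N → zetaSum l W D N + zetaSum l W' D N ≡ zetaSum l (λ ms ds → W ms ds + W' ms ds) D N
zetaSum-+ zero W W' D N = guard-+ N 0 (W [] []) (W' [] [])
zetaSum-+ (suc l) W W' D N = trans (sym (Σ-+ N _ _)) (Σ-cong N (λ d _ _ → trans (sym (Σ-+ N _ _)) (Σ-cong N (λ m _ _ →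
  trans (guard-+ (m ℕ.* (D ℕ.+ d)) N _ _)
        (cong (guard (m ℕ.* (D ℕ.+ d)) N) (zetaSum-+ l _ _ (D ℕ.+ d) (N ∸ m ℕ.* (D ℕ.+ d))))))))

zetaSum-0 : ∀ l D N → zetaSum l (λ _ _ → 0ℚ) D N ≡ 0ℚ
zetaSum-0 zero D N = guard-0 N 0
zetaSum-0 (suc l) D N = Σ-vanish N (λ d _ _ → Σ-vanish N (λ m _ _ →
  trans (cong (guard (m ℕ.* (D ℕ.+ d)) N) (zetaSum-0 l (D ℕ.+ d) (N ∸ m ℕ.* (D ℕ.+ d)))) (guard-0 (m ℕ.* (D ℕ.+ d)) N)))

zetaSum-Σ : ∀ K l (F : ℕ → Weight) D N →
  Σ[1… K ] (λ j → zetaSum l (F j) D N) ≡ zetaSum l (λ ms ds → Σ[1… K ] (λ j → F j ms ds)) D N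
zetaSum-Σ zero l F D N = sym (zetaSum-0 l D N)
zetaSum-Σ (suc K) l F D N = trans (cong (_+ zetaSum l (F (suc K)) D N) (zetaSum-Σ K l F D N)) (zetaSum-+ l _ _ D N)

zetaSum-cong : ∀ l W W' D N → (∀ ms ds → length ms ≡ l → W ms ds ≡ W' ms ds) → zetaSum l W D N ≡ zetaSum l W' D N
zetaSum-cong zero W W' D N h = cong (guard N 0) (h [] [] refl)
zetaSum-cong (suc l) W W' D N h = Σ-cong N (λ d _ _ → Σ-cong N (λ m _ _ → cong (guard (m ℕ.* (D ℕ.+ d)) N)
  (zetaSum-cong l _ _ (D ℕ.+ d) (N ∸ m ℕ.* (D ℕ.+ d)) (λ ms ds len → h (m ∷ ms) (d ∷ ds) (cong suc len)))))

biSum-* : ∀ l c W D b N → biSum l (λ ns ds → c * W ns ds) D b N ≡ c * biSum l W D b N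
biSum-* zero c W D b N = guard-* N 0 c (W [] [])
biSum-* (suc l) c W D b N = trans
  (Σ-cong (b ∸ 1) (λ n _ _ → Σ-cong N (λ d _ _ →
    trans (cong (guard (n ℕ.* (D ℕ.+ d)) N) (biSum-* l c _ 0 n (N ∸ n ℕ.* (D ℕ.+ d)))) (guard-* (n ℕ.* (D ℕ.+ d)) N c _))))
  (trans (Σ-cong (b ∸ 1) (λ n _ _ → Σ-*ˡ N c _)) (Σ-*ˡ (b ∸ 1) c _))

biColumn : ℕ → ℕ → ℕ → ℕ → ℚ
biColumn s r n d = (n ℕ.^ r ℕ.* d ℕ.^ (s ∸ 1)) /! r ! (s ∸ 1)

zetaColumn : ℕ → ℕ → ℕ → ℕ → ℚ
zetaColumn s r m d = (m ℕ.^ (r ∸ 1) ℕ.* d ℕ.^ (s ∸ 1)) /! (r ∸ 1) ! (s ∸ 1)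

biWeight : List (ℕ × ℕ) → Weight
biWeight [] ns ds = 1ℚ
biWeight ((s , r) ∷ cols) ns ds = biColumn s r (head₀ ns) (head₀ ds) * biWeight cols (tail₀ ns) (tail₀ ds)

zetaWeight : List (ℕ × ℕ) → Weight
zetaWeight [] ms ds = 1ℚ
zetaWeight ((s , r) ∷ cols) ms ds = zetaColumn s r (head₀ ms) (head₀ ds) * zetaWeight cols (tail₀ ms) (tail₀ ds)

biAux-biSum : ∀ cols {l} → length cols ≡ l → ∀ m N → biAux cols m N ≡ biSum l (biWeight cols) 0 m N
biAux-biSum [] refl m N = refl
biAux-biSum ((s , r) ∷ cols) {suc l} len m N = Σ-cong (m ∸ 1) (λ n _ _ → Σ-cong N (λ d _ _ → cong (guard (n ℕ.* d) N)
  (trans (cong (biColumn s r n d *_) (biAux-biSum cols (ℕP.suc-injective len) n (N ∸ n ℕ.* d)))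
         (sym (biSum-* l (biColumn s r n d) (biWeight cols) 0 n (N ∸ n ℕ.* d))))))

zAux-zetaSum : ∀ cols {l} → length cols ≡ l → ∀ D N → zAux cols D N ≡ zetaSum l (zetaWeight cols) D N
zAux-zetaSum [] refl D N = refl
zAux-zetaSum ((s , r) ∷ cols) {suc l} len D N = Σ-cong N (λ d _ _ → Σ-cong N (λ m _ _ → cong (guard (m ℕ.* (D ℕ.+ d)) N)
  (trans (cong (zetaColumn s r m d *_) (zAux-zetaSum cols (ℕP.suc-injective len) (D ℕ.+ d) (N ∸ m ℕ.* (D ℕ.+ d))))
         (sym (zetaSum-* l (zetaColumn s r m d) (zetaWeight cols) (D ℕ.+ d) (N ∸ m ℕ.* (D ℕ.+ d)))))))

-- Fractions a / x of naturals (x ≠ 0) inside ℚ, built from the unnormalised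
-- rational a / (pred x + 1): products and cross-multiplication are then
-- checked on unnormalised rationals, where no gcd has to be computed.
frac : ℕ → ℕ → ℚ
frac a x = fromℚᵘ (mkℚᵘ (ℤ.+ a) (ℕ.pred x))

fromℚᵘ-* : ∀ p q → fromℚᵘ p * fromℚᵘ q ≡ fromℚᵘ (p ℚᵘ.* q)
fromℚᵘ-* p q = ℚP.toℚᵘ-injective (ℚᵘP.≃-trans (ℚP.toℚᵘ-homo-* (fromℚᵘ p) (fromℚᵘ q))
  (ℚᵘP.≃-trans (ℚᵘP.*-cong (ℚP.toℚᵘ-fromℚᵘ p) (ℚP.toℚᵘ-fromℚᵘ q)) (ℚᵘP.≃-sym (ℚP.toℚᵘ-fromℚᵘ (p ℚᵘ.* q)))))

fromℚᵘ-+ : ∀ p q → fromℚᵘ p + fromℚᵘ q ≡ fromℚᵘ (p ℚᵘ.+ q)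
fromℚᵘ-+ p q = ℚP.toℚᵘ-injective (ℚᵘP.≃-trans (ℚP.toℚᵘ-homo-+ (fromℚᵘ p) (fromℚᵘ q))
  (ℚᵘP.≃-trans (ℚᵘP.+-cong (ℚP.toℚᵘ-fromℚᵘ p) (ℚP.toℚᵘ-fromℚᵘ q)) (ℚᵘP.≃-sym (ℚP.toℚᵘ-fromℚᵘ (p ℚᵘ.+ q)))))

/-frac : ∀ a x .{{_ : NonZero x}} → (ℤ.+ a) / x ≡ frac a x
/-frac a x = ℚP./-cong {ℤ.+ a} {x} {ℤ.+ a} {suc (ℕ.pred x)} refl (sym (ℕP.suc-pred x))

frac-* : ∀ a x b y .{{_ : NonZero x}} .{{_ : NonZero y}} → frac a x * frac b y ≡ frac (a ℕ.* b) (x ℕ.* y)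
frac-* a x b y = trans (fromℚᵘ-* (mkℚᵘ (ℤ.+ a) (ℕ.pred x)) (mkℚᵘ (ℤ.+ b) (ℕ.pred y)))
  (cong₂ (λ n k → fromℚᵘ (mkℚᵘ n k)) (sym (ℤP.pos-* a b))
         (cong ℕ.pred (cong₂ ℕ._*_ (ℕP.suc-pred x) (ℕP.suc-pred y))))

frac-cross : ∀ a x b y .{{_ : NonZero x}} .{{_ : NonZero y}} → a ℕ.* y ≡ b ℕ.* x → frac a x ≡ frac b y
frac-cross a x b y eq = ℚP.fromℚᵘ-cong {mkℚᵘ (ℤ.+ a) (ℕ.pred x)} {mkℚᵘ (ℤ.+ b) (ℕ.pred y)} (ℚᵘ.*≡*
  (trans (sym (ℤP.pos-* a _)) (trans (cong ℤ.+_ eq′) (ℤP.pos-* b _))))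
  where
  eq′ : a ℕ.* suc (ℕ.pred y) ≡ b ℕ.* suc (ℕ.pred x)
  eq′ = trans (cong (a ℕ.*_) (ℕP.suc-pred y)) (trans eq (cong (b ℕ.*_) (sym (ℕP.suc-pred x))))

⟦⟧-+ : ∀ a b → ⟦ a ℕ.+ b ⟧ ≡ ⟦ a ⟧ + ⟦ b ⟧
⟦⟧-+ a b = sym (trans (fromℚᵘ-+ (mkℚᵘ (ℤ.+ a) 0) (mkℚᵘ (ℤ.+ b) 0))
  (ℚP.fromℚᵘ-cong {mkℚᵘ (ℤ.+ a) 0 ℚᵘ.+ mkℚᵘ (ℤ.+ b) 0} {mkℚᵘ (ℤ.+ (a ℕ.+ b)) 0} (ℚᵘ.*≡* (cong (ℤ._* ℤ.+ 1)
    (trans (cong₂ ℤ._+_ (ℤP.*-identityʳ (ℤ.+ a)) (ℤP.*-identityʳ (ℤ.+ b))) (sym (ℤP.pos-+ a b)))))))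

⟦⟧-* : ∀ a b → ⟦ a ℕ.* b ⟧ ≡ ⟦ a ⟧ * ⟦ b ⟧
⟦⟧-* a b = sym (frac-* a 1 b 1)

⟦⟧-^ : ∀ n k → ⟦ n ℕ.^ k ⟧ ≡ ⟦ n ⟧ ^ k
⟦⟧-^ n zero = refl
⟦⟧-^ n (suc k) = trans (⟦⟧-* n (n ℕ.^ k)) (cong (⟦ n ⟧ *_) (⟦⟧-^ n k))

·-⟦⟧ : ∀ n q → n · q ≡ ⟦ n ⟧ * q
·-⟦⟧ zero q = sym (ℚP.*-zeroˡ q)
·-⟦⟧ (suc n) q = begin
    q + n · q         ≡⟨ cong (q +_) (·-⟦⟧ n q) ⟩
    q + ⟦ n ⟧ * q     ≡⟨ cong (_+ ⟦ n ⟧ * q) (sym (ℚP.*-identityˡ q)) ⟩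
    1ℚ * q + ⟦ n ⟧ * q ≡⟨ sym (ℚP.*-distribʳ-+ q 1ℚ ⟦ n ⟧) ⟩
    (1ℚ + ⟦ n ⟧) * q  ≡⟨ cong (_* q) (sym (⟦⟧-+ 1 n)) ⟩
    ⟦ suc n ⟧ * q     ∎
  where open ≡-Reasoning

inv! : ℕ → ℚ
inv! k = frac 1 (k !)

dpow : ℚ → ℕ → ℚ
dpow x k = x ^ k * inv! k

frac-split : ∀ a x .{{_ : NonZero x}} → frac a x ≡ ⟦ a ⟧ * frac 1 x
frac-split a x = sym (trans (frac-* a 1 1 x) (cong₂ frac (ℕP.*-identityʳ a) (ℕP.*-identityˡ x)))

column-dpow : ∀ n r d q → (n ℕ.^ r ℕ.* d ℕ.^ q) /! r ! q ≡ dpow ⟦ n ⟧ r * dpow ⟦ d ⟧ q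
column-dpow n r d q = begin
    (n ℕ.^ r ℕ.* d ℕ.^ q) /! r ! q
      ≡⟨ /-frac (n ℕ.^ r ℕ.* d ℕ.^ q) (r ! ℕ.* q !) {{r ℕP.!* q !≢0}} ⟩
    frac (n ℕ.^ r ℕ.* d ℕ.^ q) (r ! ℕ.* q !)
      ≡⟨ sym (frac-* (n ℕ.^ r) (r !) (d ℕ.^ q) (q !) {{r ℕP.!≢0}} {{q ℕP.!≢0}}) ⟩
    frac (n ℕ.^ r) (r !) * frac (d ℕ.^ q) (q !)
      ≡⟨ cong₂ _*_ (frac-split (n ℕ.^ r) (r !) {{r ℕP.!≢0}}) (frac-split (d ℕ.^ q) (q !) {{q ℕP.!≢0}}) ⟩
    (⟦ n ℕ.^ r ⟧ * inv! r) * (⟦ d ℕ.^ q ⟧ * inv! q)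
      ≡⟨ cong₂ (λ a b → (a * inv! r) * (b * inv! q)) (⟦⟧-^ n r) (⟦⟧-^ d q) ⟩
    dpow ⟦ n ⟧ r * dpow ⟦ d ⟧ q ∎
  where open ≡-Reasoning

C-inv! : ∀ {n k} → k ≤ n → ⟦ n C k ⟧ * inv! n ≡ inv! k * inv! (n ∸ k)
C-inv! {n} {k} k≤n = begin
    ⟦ n C k ⟧ * inv! n             ≡⟨ frac-* (n C k) 1 1 (n !) {{_}} {{n ℕP.!≢0}} ⟩
    frac ((n C k) ℕ.* 1) (1 ℕ.* n !) ≡⟨ cong₂ frac (ℕP.*-identityʳ (n C k)) (ℕP.*-identityˡ (n !)) ⟩
    frac (n C k) (n !)              ≡⟨ frac-cross (n C k) (n !) 1 (k ! ℕ.* (n ∸ k) !) {{n ℕP.!≢0}} {{k ℕP.!* (n ∸ k) !≢0}} factorials ⟩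
    frac 1 (k ! ℕ.* (n ∸ k) !)      ≡⟨ sym (frac-* 1 (k !) 1 ((n ∸ k) !) {{k ℕP.!≢0}} {{(n ∸ k) ℕP.!≢0}}) ⟩
    inv! k * inv! (n ∸ k)          ∎
  where
  open ≡-Reasoning
  factorials : (n C k) ℕ.* (k ! ℕ.* (n ∸ k) !) ≡ 1 ℕ.* n !
  factorials = begin
      (n C k) ℕ.* (k ! ℕ.* (n ∸ k) !) ≡⟨ cong (ℕ._* (k ! ℕ.* (n ∸ k) !)) (nCk≡n!/k![n-k]! k≤n) ⟩
      _                             ≡⟨ m/n*n≡m {{k ℕP.!* (n ∸ k) !≢0}} (k![n∸k]!∣n! k≤n) ⟩
      n !                           ≡⟨ sym (ℕP.*-identityˡ (n !)) ⟩
      1 ℕ.* n !                     ∎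

dpow-merge : ∀ x p q → dpow x p * dpow x q ≡ ⟦ (p ℕ.+ q) C p ⟧ * dpow x (p ℕ.+ q)
dpow-merge x p q = begin
    (x ^ p * inv! p) * (x ^ q * inv! q)
      ≡⟨ solve 4 (λ a b c d → (a :* b) :* (c :* d) := (a :* c) :* (b :* d)) refl (x ^ p) (inv! p) (x ^ q) (inv! q) ⟩
    (x ^ p * x ^ q) * (inv! p * inv! q)
      ≡⟨ cong₂ _*_ (sym (^-homo-* x p q)) (sym (trans (C-inv! (ℕP.m≤m+n p q)) (cong (λ z → inv! p * inv! z) (ℕP.m+n∸m≡n p q)))) ⟩
    x ^ (p ℕ.+ q) * (⟦ (p ℕ.+ q) C p ⟧ * inv! (p ℕ.+ q))
      ≡⟨ solve 3 (λ a b c → a :* (b :* c) := b :* (a :* c)) refl (x ^ (p ℕ.+ q)) ⟦ (p ℕ.+ q) C p ⟧ (inv! (p ℕ.+ q)) ⟩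
    ⟦ (p ℕ.+ q) C p ⟧ * dpow x (p ℕ.+ q) ∎
  where open ≡-Reasoning

Σ[0…_] : ℕ → (ℕ → ℚ) → ℚ
Σ[0… n ] f = Σ[1… suc n ] (λ j → f (j ∸ 1))

Σ-first : ∀ n (f : ℕ → ℚ) → Σ[1… suc n ] f ≡ f 1 + Σ[1… n ] (λ j → f (suc j))
Σ-first zero f = trans (ℚP.+-identityˡ (f 1)) (sym (ℚP.+-identityʳ (f 1)))
Σ-first (suc n) f = trans (cong (_+ f (suc (suc n))) (Σ-first n f)) (ℚP.+-assoc (f 1) _ (f (suc (suc n))))

sum≡Σ[0…] : ∀ n (f : ℕ → ℚ) → sum {suc n} (λ k → f (toℕ k)) ≡ Σ[0… n ] f
sum≡Σ[0…] zero f = trans (ℚP.+-identityʳ (f 0)) (sym (ℚP.+-identityˡ (f 0)))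
sum≡Σ[0…] (suc n) f = begin
    f 0 + sum {suc n} (λ k → f (suc (toℕ k)))        ≡⟨ cong (f 0 +_) (sum≡Σ[0…] n (λ k → f (suc k))) ⟩
    f 0 + Σ[1… suc n ] (λ j → f (suc (j ∸ 1)))      ≡⟨ cong (f 0 +_) (Σ-cong (suc n) (λ { (suc j) _ _ → refl })) ⟩
    f 0 + Σ[1… suc n ] f                            ≡⟨ sym (Σ-first (suc n) (λ j → f (j ∸ 1))) ⟩
    Σ[0… suc n ] f                                  ∎
  where open ≡-Reasoning

dpow-+ : ∀ x y n → dpow (x + y) n ≡ Σ[0… n ] (λ k → dpow x k * dpow y (n ∸ k))
dpow-+ x y n = begin
    (x + y) ^ n * inv! n
      ≡⟨ cong (_* inv! n) (Binomial.theorem n x y) ⟩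
    sum {suc n} (λ k → (n C toℕ k) · (x ^ toℕ k * y ^ (n ∸ toℕ k))) * inv! n
      ≡⟨ cong (_* inv! n) (sum≡Σ[0…] n (λ k → (n C k) · (x ^ k * y ^ (n ∸ k)))) ⟩
    Σ[0… n ] (λ k → (n C k) · (x ^ k * y ^ (n ∸ k))) * inv! n
      ≡⟨ sym (Σ-*ʳ (suc n) (inv! n) _) ⟩
    Σ[0… n ] (λ k → (n C k) · (x ^ k * y ^ (n ∸ k)) * inv! n)
      ≡⟨ Σ-cong (suc n) (λ { (suc k) _ (s≤s k≤n) → term k k≤n }) ⟩
    Σ[0… n ] (λ k → dpow x k * dpow y (n ∸ k)) ∎
  where
  open ≡-Reasoning
  term : ∀ k → k ≤ n → (n C k) · (x ^ k * y ^ (n ∸ k)) * inv! n ≡ dpow x k * dpow y (n ∸ k)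
  term k k≤n = begin
      (n C k) · (x ^ k * y ^ (n ∸ k)) * inv! n
        ≡⟨ cong (_* inv! n) (·-⟦⟧ (n C k) _) ⟩
      ⟦ n C k ⟧ * (x ^ k * y ^ (n ∸ k)) * inv! n
        ≡⟨ solve 4 (λ c a b i → c :* (a :* b) :* i := (a :* b) :* (c :* i)) refl ⟦ n C k ⟧ (x ^ k) (y ^ (n ∸ k)) (inv! n) ⟩
      (x ^ k * y ^ (n ∸ k)) * (⟦ n C k ⟧ * inv! n)
        ≡⟨ cong ((x ^ k * y ^ (n ∸ k)) *_) (C-inv! k≤n) ⟩
      (x ^ k * y ^ (n ∸ k)) * (inv! k * inv! (n ∸ k))
        ≡⟨ solve 4 (λ a b c d → (a :* b) :* (c :* d) := (a :* c) :* (b :* d)) refl (x ^ k) (y ^ (n ∸ k)) (inv! k) (inv! (n ∸ k)) ⟩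
      dpow x k * dpow y (n ∸ k) ∎

dpow-neg : ∀ y k → dpow (- y) k ≡ sgn k * dpow y k
dpow-neg y k = trans (cong (_* inv! k) (^-neg k)) (ℚP.*-assoc (sgn k) (y ^ k) (inv! k))
  where
  ^-neg : ∀ k → (- y) ^ k ≡ sgn k * y ^ k
  ^-neg zero = refl
  ^-neg (suc k) = trans (cong (- y *_) (^-neg k))
    (solve 3 (λ y s p → (:- y) :* (s :* p) := (:- s) :* (y :* p)) refl y (sgn k) (y ^ k))

-- Two consequences of the binomial theorem, in the index ranges that the
-- coefficient combinations T (first identity) and U (second identity) use.

expand-difference : ∀ x y k →
  dpow x k ≡ Σ[1… suc k ] (λ i → sgn (suc k ∸ i) * (dpow (x + y) (i ∸ 1) * dpow y (suc k ∸ i)))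
expand-difference x y k = begin
    dpow x k                ≡⟨ cong (λ z → dpow z k) (solve 2 (λ x y → x := (x :+ y) :+ (:- y)) refl x y) ⟩
    dpow (x + y + - y) k    ≡⟨ dpow-+ (x + y) (- y) k ⟩
    Σ[0… k ] (λ u → dpow (x + y) u * dpow (- y) (k ∸ u))
      ≡⟨ Σ-cong (suc k) (λ { (suc u) _ _ → signed u }) ⟩
    Σ[1… suc k ] (λ i → sgn (suc k ∸ i) * (dpow (x + y) (i ∸ 1) * dpow y (suc k ∸ i))) ∎
  where
  open ≡-Reasoning
  signed : ∀ u → dpow (x + y) u * dpow (- y) (k ∸ u) ≡ sgn (k ∸ u) * (dpow (x + y) u * dpow y (k ∸ u))
  signed u = trans (cong (dpow (x + y) u *_) (dpow-neg y (k ∸ u)))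
    (solve 3 (λ a s b → a :* (s :* b) := s :* (a :* b)) refl (dpow (x + y) u) (sgn (k ∸ u)) (dpow y (k ∸ u)))

dpow-+-* : ∀ x y a b →
  dpow (x + y) a * dpow y b ≡ Σ[0… a ] (λ u → ⟦ (b ℕ.+ u) C b ⟧ * (dpow x (a ∸ u) * dpow y (b ℕ.+ u)))
dpow-+-* x y a b = begin
    dpow (x + y) a * dpow y b
      ≡⟨ cong (λ z → dpow z a * dpow y b) (ℚP.+-comm x y) ⟩
    dpow (y + x) a * dpow y b
      ≡⟨ cong (_* dpow y b) (dpow-+ y x a) ⟩
    Σ[0… a ] (λ u → dpow y u * dpow x (a ∸ u)) * dpow y b
      ≡⟨ sym (Σ-*ʳ (suc a) (dpow y b) _) ⟩
    Σ[0… a ] (λ u → dpow y u * dpow x (a ∸ u) * dpow y b)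
      ≡⟨ Σ-cong (suc a) (λ { (suc u) _ _ → merged u }) ⟩
    Σ[0… a ] (λ u → ⟦ (b ℕ.+ u) C b ⟧ * (dpow x (a ∸ u) * dpow y (b ℕ.+ u))) ∎
  where
  open ≡-Reasoning
  merged : ∀ u → dpow y u * dpow x (a ∸ u) * dpow y b ≡ ⟦ (b ℕ.+ u) C b ⟧ * (dpow x (a ∸ u) * dpow y (b ℕ.+ u))
  merged u = begin
      dpow y u * dpow x (a ∸ u) * dpow y b
        ≡⟨ solve 3 (λ p q r → p :* q :* r := q :* (r :* p)) refl (dpow y u) (dpow x (a ∸ u)) (dpow y b) ⟩
      dpow x (a ∸ u) * (dpow y b * dpow y u)
        ≡⟨ cong (dpow x (a ∸ u) *_) (dpow-merge y b u) ⟩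
      dpow x (a ∸ u) * (⟦ (b ℕ.+ u) C b ⟧ * dpow y (b ℕ.+ u))
        ≡⟨ solve 3 (λ p c q → p :* (c :* q) := c :* (p :* q)) refl (dpow x (a ∸ u)) ⟦ (b ℕ.+ u) C b ⟧ (dpow y (b ℕ.+ u)) ⟩
      ⟦ (b ℕ.+ u) C b ⟧ * (dpow x (a ∸ u) * dpow y (b ℕ.+ u)) ∎

-- The same, with j = b + u + 1 ranging over 1 … a + b + 1: the added
-- terms j ≤ b vanish because C(j-1, b) = 0 there.
expand-sum : ∀ x y a b → dpow (x + y) a * dpow y b ≡
  Σ[1… suc a ℕ.+ suc b ∸ 1 ] (λ j → ⟦ (j ∸ 1) C b ⟧ * (dpow x ((suc a ℕ.+ suc b ∸ j) ∸ 1) * dpow y (j ∸ 1)))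
expand-sum x y a b = sym (begin
    Σ[1… a ℕ.+ suc b ] f                     ≡⟨ cong (λ z → Σ[1… z ] f) (trans (ℕP.+-suc a b) (cong suc (ℕP.+-comm a b))) ⟩
    Σ[1… suc (b ℕ.+ a) ] f                   ≡⟨ cong (λ z → Σ[1… z ] f) (sym (ℕP.+-suc b a)) ⟩
    Σ[1… b ℕ.+ suc a ] f                     ≡⟨ Σ-split b (suc a) f ⟩
    Σ[1… b ] f + Σ[1… suc a ] (λ u → f (b ℕ.+ u)) ≡⟨ cong₂ _+_ (Σ-vanish b below) (Σ-cong (suc a) shifted) ⟩
    0ℚ + Σ[0… a ] (λ u → ⟦ (b ℕ.+ u) C b ⟧ * (dpow x (a ∸ u) * dpow y (b ℕ.+ u)))
      ≡⟨ ℚP.+-identityˡ _ ⟩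
    Σ[0… a ] (λ u → ⟦ (b ℕ.+ u) C b ⟧ * (dpow x (a ∸ u) * dpow y (b ℕ.+ u)))
      ≡⟨ sym (dpow-+-* x y a b) ⟩
    dpow (x + y) a * dpow y b ∎)
  where
  open ≡-Reasoning
  f : ℕ → ℚ
  f j = ⟦ (j ∸ 1) C b ⟧ * (dpow x ((suc a ℕ.+ suc b ∸ j) ∸ 1) * dpow y (j ∸ 1))
  below : ∀ j → 1 ≤ j → j ≤ b → f j ≡ 0ℚ
  below (suc t) _ t<b = trans (cong (λ c → ⟦ c ⟧ * rest) (k>n⇒nCk≡0 t<b)) (ℚP.*-zeroˡ rest)
    where rest = dpow x ((suc a ℕ.+ suc b ∸ suc t) ∸ 1) * dpow y t
  shifted : ∀ u → 1 ≤ u → u ≤ suc a → f (b ℕ.+ u) ≡ ⟦ (b ℕ.+ (u ∸ 1)) C b ⟧ * (dpow x (a ∸ (u ∸ 1)) * dpow y (b ℕ.+ (u ∸ 1)))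
  shifted (suc u) _ (s≤s u≤a) = begin
      f (b ℕ.+ suc u) ≡⟨ cong f (ℕP.+-suc b u) ⟩
      ⟦ (b ℕ.+ u) C b ⟧ * (dpow x ((a ℕ.+ suc b ∸ (b ℕ.+ u)) ∸ 1) * dpow y (b ℕ.+ u))
        ≡⟨ cong (λ w → ⟦ (b ℕ.+ u) C b ⟧ * (dpow x w * dpow y (b ℕ.+ u))) remaining ⟩
      ⟦ (b ℕ.+ u) C b ⟧ * (dpow x (a ∸ u) * dpow y (b ℕ.+ u)) ∎
    where
    remaining : (a ℕ.+ suc b ∸ (b ℕ.+ u)) ∸ 1 ≡ a ∸ u
    remaining = begin
        (a ℕ.+ suc b ∸ (b ℕ.+ u)) ∸ 1 ≡⟨ cong (λ w → (w ∸ (b ℕ.+ u)) ∸ 1) (trans (ℕP.+-suc a b) (cong suc (ℕP.+-comm a b))) ⟩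
        (suc (b ℕ.+ a) ∸ (b ℕ.+ u)) ∸ 1 ≡⟨ cong (_∸ 1) (ℕP.+-∸-assoc 1 (ℕP.+-monoʳ-≤ b u≤a)) ⟩
        (b ℕ.+ a) ∸ (b ℕ.+ u) ≡⟨ ℕP.[m+n]∸[m+o]≡n∸o b a u ⟩
        a ∸ u ∎

T-cong : ∀ rs c (k k' : List ℕ → ℚ) → (∀ b → length b ≡ suc (length rs) → k b ≡ k' b) → T c rs k ≡ T c rs k'
T-cong [] c k k' h = h (c ∷ []) refl
T-cong (r ∷ rs) c k k' h = Σ-cong (c ℕ.+ r ∸ 1) (λ j _ _ → cong (⟦ (j ∸ 1) C (r ∸ 1) ⟧ *_)
  (T-cong rs j _ _ (λ b len → h ((c ℕ.+ r ∸ j) ∷ b) (cong suc len))))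

T-* : ∀ rs c x (k : List ℕ → ℚ) → T c rs (λ b → x * k b) ≡ x * T c rs k
T-* [] c x k = refl
T-* (r ∷ rs) c x k = trans (Σ-cong (c ℕ.+ r ∸ 1) (λ j _ _ →
    trans (cong (⟦ (j ∸ 1) C (r ∸ 1) ⟧ *_) (T-* rs j x _))
      (solve 3 (λ a b c → a :* (b :* c) := b :* (a :* c)) refl ⟦ (j ∸ 1) C (r ∸ 1) ⟧ x (T j rs (λ b → k ((c ℕ.+ r ∸ j) ∷ b))))))
  (Σ-*ˡ (c ℕ.+ r ∸ 1) x _)

T-zetaSum : ∀ rs c l (F : List ℕ → Weight) D N →
  T c rs (λ b → zetaSum l (F b) D N) ≡ zetaSum l (λ ms ds → T c rs (λ b → F b ms ds)) D N
T-zetaSum [] c l F D N = refl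
T-zetaSum (r ∷ rs) c l F D N = trans (Σ-cong (c ℕ.+ r ∸ 1) (λ j _ _ → let coeff = ⟦ (j ∸ 1) C (r ∸ 1) ⟧ in
    trans (cong (coeff *_) (T-zetaSum rs j l (λ b → F ((c ℕ.+ r ∸ j) ∷ b)) D N))
          (sym (zetaSum-* l coeff (λ ms ds → T j rs (λ b → F ((c ℕ.+ r ∸ j) ∷ b) ms ds)) D N))))
  (zetaSum-Σ (c ℕ.+ r ∸ 1) l _ D N)

U-cong : ∀ rs p (k k' : List ℕ → ℚ) → (∀ b → length b ≡ length rs → k b ≡ k' b) → U p rs k ≡ U p rs k'
U-cong [] p k k' h = refl
U-cong (r ∷ []) p k k' h = cong (⟦ (p ℕ.+ r ∸ 1) C p ⟧ *_) (h _ refl)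
U-cong (r ∷ rs@(_ ∷ _)) p k k' h = Σ-cong r (λ i _ _ → cong ((sgn (r ∸ i) * ⟦ (p ℕ.+ i ∸ 1) C p ⟧) *_)
  (U-cong rs (r ∸ i) _ _ (λ b len → h ((p ℕ.+ i ∸ 1) ∷ b) (cong suc len))))

U-* : ∀ rs p x (k : List ℕ → ℚ) → U p rs (λ b → x * k b) ≡ x * U p rs k
U-* [] p x k = sym (ℚP.*-zeroʳ x)
U-* (r ∷ []) p x k = solve 3 (λ a b c → a :* (b :* c) := b :* (a :* c)) refl ⟦ (p ℕ.+ r ∸ 1) C p ⟧ x (k ((p ℕ.+ r ∸ 1) ∷ []))
U-* (r ∷ rs@(_ ∷ _)) p x k = trans (Σ-cong r (λ i _ _ → let c = sgn (r ∸ i) * ⟦ (p ℕ.+ i ∸ 1) C p ⟧ in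
    trans (cong (c *_) (U-* rs (r ∸ i) x _))
      (solve 3 (λ a b c → a :* (b :* c) := b :* (a :* c)) refl c x (U (r ∸ i) rs (λ b → k ((p ℕ.+ i ∸ 1) ∷ b))))))
  (Σ-*ˡ r x _)

U-zetaSum : ∀ rs p l (F : List ℕ → Weight) D N →
  U p rs (λ b → zetaSum l (F b) D N) ≡ zetaSum l (λ ms ds → U p rs (λ b → F b ms ds)) D N
U-zetaSum [] p l F D N = sym (zetaSum-0 l D N)
U-zetaSum (r ∷ []) p l F D N = sym (zetaSum-* l ⟦ (p ℕ.+ r ∸ 1) C p ⟧ _ D N)
U-zetaSum (r ∷ rs@(_ ∷ _)) p l F D N = trans (Σ-cong r (λ i _ _ → let c = sgn (r ∸ i) * ⟦ (p ℕ.+ i ∸ 1) C p ⟧ in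
    trans (cong (c *_) (U-zetaSum rs (r ∸ i) l (λ b → F ((p ℕ.+ i ∸ 1) ∷ b)) D N))
          (sym (zetaSum-* l c (λ ms ds → U (r ∸ i) rs (λ b → F ((p ℕ.+ i ∸ 1) ∷ b) ms ds)) D N))))
  (zetaSum-Σ r l _ D N)

-- With n = suffixSums m,
-- the bi-bracket weight with bottom row (c-1, r₂-1, …) equals the
-- T-combination of q-zeta weights: column by column this is `expand-sum`
-- with x = m₁ and y = n₂, the factor d₁^(s₁-1)/(s₁-1)! riding along.
bi-as-zeta : ∀ rs c (s ms ds : List ℕ) → 1 ≤ c → LA.All (1 ≤_) rs →
  length s ≡ suc (length rs) → length ms ≡ suc (length rs) →
  biWeight (L.zip s ((c ∸ 1) ∷ L.map (_∸ 1) rs)) (suffixSums ms) ds ≡ T c rs (λ b → zetaWeight (L.zip s b) ms ds)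
bi-as-zeta [] c (s₁ ∷ []) (m₁ ∷ []) ds _ _ _ _ = cong (λ n → biColumn s₁ (c ∸ 1) n (head₀ ds) * 1ℚ) (ℕP.+-identityʳ m₁)
bi-as-zeta [] c (s₁ ∷ []) [] ds _ _ _ ()
bi-as-zeta [] c (s₁ ∷ []) (_ ∷ _ ∷ _) ds _ _ _ ()
bi-as-zeta [] c [] ms ds _ _ () _
bi-as-zeta [] c (_ ∷ _ ∷ _) ms ds _ _ () _
bi-as-zeta (r₂ ∷ rs) c [] ms ds _ _ () _
bi-as-zeta (r₂ ∷ rs) c (_ ∷ []) ms ds _ _ () _
bi-as-zeta (r₂ ∷ rs) c (s₁ ∷ s₂ ∷ s) [] ds _ _ _ ()
bi-as-zeta (r₂ ∷ rs) c (s₁ ∷ s₂ ∷ s) (_ ∷ []) ds _ _ _ ()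
bi-as-zeta (suc b ∷ rs) (suc a) (s₁ ∷ s₂ ∷ s) (m₁ ∷ m₂ ∷ ms) ds _ (_ LA.∷ 1≤rs) ls lm = sym (begin
    Σ[1… suc a ℕ.+ suc b ∸ 1 ] (λ j → ⟦ (j ∸ 1) C b ⟧ * T j rs (λ bb → zetaColumn s₁ (suc a ℕ.+ suc b ∸ j) m₁ d₁ * Z bb))
      ≡⟨ Σ-cong (suc a ℕ.+ suc b ∸ 1) term ⟩
    Σ[1… suc a ℕ.+ suc b ∸ 1 ] (λ j → (⟦ (j ∸ 1) C b ⟧ * (dpow ⟦ m₁ ⟧ ((suc a ℕ.+ suc b ∸ j) ∸ 1) * dpow ⟦ n₂ ⟧ (j ∸ 1))) * K)
      ≡⟨ Σ-*ʳ (suc a ℕ.+ suc b ∸ 1) K _ ⟩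
    Σ[1… suc a ℕ.+ suc b ∸ 1 ] (λ j → ⟦ (j ∸ 1) C b ⟧ * (dpow ⟦ m₁ ⟧ ((suc a ℕ.+ suc b ∸ j) ∸ 1) * dpow ⟦ n₂ ⟧ (j ∸ 1))) * K
      ≡⟨ cong (_* K) (sym (expand-sum ⟦ m₁ ⟧ ⟦ n₂ ⟧ a b)) ⟩
    (dpow (⟦ m₁ ⟧ + ⟦ n₂ ⟧) a * dpow ⟦ n₂ ⟧ b) * K
      ≡⟨ cong (λ x → (dpow x a * dpow ⟦ n₂ ⟧ b) * K) (sym (⟦⟧-+ m₁ n₂)) ⟩
    (dpow ⟦ m₁ ℕ.+ n₂ ⟧ a * dpow ⟦ n₂ ⟧ b) * K
      ≡⟨ solve 5 (λ x y p q r → (x :* y) :* (p :* (q :* r)) := (x :* p) :* ((y :* q) :* r)) refl (dpow ⟦ m₁ ℕ.+ n₂ ⟧ a) (dpow ⟦ n₂ ⟧ b) δ₁ δ₂ R ⟩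
    (dpow ⟦ m₁ ℕ.+ n₂ ⟧ a * δ₁) * ((dpow ⟦ n₂ ⟧ b * δ₂) * R)
      ≡⟨ sym (cong₂ (λ u v → u * (v * R)) (column-dpow (m₁ ℕ.+ n₂) a d₁ (s₁ ∸ 1)) (column-dpow n₂ b d₂ (s₂ ∸ 1))) ⟩
    biColumn s₁ a (m₁ ℕ.+ n₂) d₁ * (biColumn s₂ b n₂ d₂ * R) ∎)
  where
  open ≡-Reasoning
  d₁ = head₀ ds
  d₂ = head₀ (tail₀ ds)
  n₂ = head₀ (suffixSums (m₂ ∷ ms))
  δ₁ = dpow ⟦ d₁ ⟧ (s₁ ∸ 1)
  δ₂ = dpow ⟦ d₂ ⟧ (s₂ ∸ 1)
  R = biWeight (L.zip s (L.map (_∸ 1) rs)) (tail₀ (suffixSums (m₂ ∷ ms))) (tail₀ (tail₀ ds))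
  K = δ₁ * (δ₂ * R)
  Z : List ℕ → ℚ
  Z bb = zetaWeight (L.zip (s₂ ∷ s) bb) (m₂ ∷ ms) (tail₀ ds)
  term : ∀ j → 1 ≤ j → j ≤ suc a ℕ.+ suc b ∸ 1 →
    ⟦ (j ∸ 1) C b ⟧ * T j rs (λ bb → zetaColumn s₁ (suc a ℕ.+ suc b ∸ j) m₁ d₁ * Z bb)
    ≡ (⟦ (j ∸ 1) C b ⟧ * (dpow ⟦ m₁ ⟧ ((suc a ℕ.+ suc b ∸ j) ∸ 1) * dpow ⟦ n₂ ⟧ (j ∸ 1))) * K
  term j 1≤j _ = begin
      ⟦ (j ∸ 1) C b ⟧ * T j rs (λ bb → zetaColumn s₁ X m₁ d₁ * Z bb)
        ≡⟨ cong (⟦ (j ∸ 1) C b ⟧ *_) (T-* rs j (zetaColumn s₁ X m₁ d₁) Z) ⟩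
      ⟦ (j ∸ 1) C b ⟧ * (zetaColumn s₁ X m₁ d₁ * T j rs Z)
        ≡⟨ cong (λ z → ⟦ (j ∸ 1) C b ⟧ * (zetaColumn s₁ X m₁ d₁ * z))
             (sym (bi-as-zeta rs j (s₂ ∷ s) (m₂ ∷ ms) (tail₀ ds) 1≤j 1≤rs (ℕP.suc-injective ls) (ℕP.suc-injective lm))) ⟩
      ⟦ (j ∸ 1) C b ⟧ * (zetaColumn s₁ X m₁ d₁ * (biColumn s₂ (j ∸ 1) n₂ d₂ * R))
        ≡⟨ cong₂ (λ u v → ⟦ (j ∸ 1) C b ⟧ * (u * (v * R))) (column-dpow m₁ (X ∸ 1) d₁ (s₁ ∸ 1)) (column-dpow n₂ (j ∸ 1) d₂ (s₂ ∸ 1)) ⟩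
      ⟦ (j ∸ 1) C b ⟧ * ((dpow ⟦ m₁ ⟧ (X ∸ 1) * δ₁) * ((dpow ⟦ n₂ ⟧ (j ∸ 1) * δ₂) * R))
        ≡⟨ solve 6 (λ c x p y q r → c :* ((x :* p) :* ((y :* q) :* r)) := (c :* (x :* y)) :* (p :* (q :* r))) refl
             ⟦ (j ∸ 1) C b ⟧ (dpow ⟦ m₁ ⟧ (X ∸ 1)) δ₁ (dpow ⟦ n₂ ⟧ (j ∸ 1)) δ₂ R ⟩
      (⟦ (j ∸ 1) C b ⟧ * (dpow ⟦ m₁ ⟧ (X ∸ 1) * dpow ⟦ n₂ ⟧ (j ∸ 1))) * K ∎
    where X = suc a ℕ.+ suc b ∸ j

-- The second identity for fixed summation variables, generalised by a
-- factor n₁^p/p! (n₁ = m₁ + … + m_l) carried over from a preceding column: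
-- column by column this is `expand-difference` with x = m₁ and y = n₂,
-- followed by merging n₁^p/p! · n₁^u/u! = C(p+u, p) n₁^(p+u)/(p+u)!.
zeta-as-bi : ∀ r rs p (s ms ds : List ℕ) → LA.All (1 ≤_) (r ∷ rs) →
  length s ≡ suc (length rs) → length ms ≡ suc (length rs) →
  dpow ⟦ head₀ (suffixSums ms) ⟧ p * zetaWeight (L.zip s (r ∷ rs)) ms ds
  ≡ U p (r ∷ rs) (λ b → biWeight (L.zip s b) (suffixSums ms) ds)
zeta-as-bi zero rs p s ms ds (() LA.∷ _) _ _
zeta-as-bi (suc k) [] p (s₁ ∷ []) (m₁ ∷ []) ds _ _ _ rewrite ℕP.+-identityʳ m₁ = begin
    dpow ⟦ m₁ ⟧ p * (zetaColumn s₁ (suc k) m₁ d₁ * 1ℚ)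
      ≡⟨ cong (λ z → dpow ⟦ m₁ ⟧ p * (z * 1ℚ)) (column-dpow m₁ k d₁ (s₁ ∸ 1)) ⟩
    dpow ⟦ m₁ ⟧ p * ((dpow ⟦ m₁ ⟧ k * δ) * 1ℚ)
      ≡⟨ solve 3 (λ a b d → a :* ((b :* d) :* con 1ℚ) := (a :* b) :* d) refl (dpow ⟦ m₁ ⟧ p) (dpow ⟦ m₁ ⟧ k) δ ⟩
    (dpow ⟦ m₁ ⟧ p * dpow ⟦ m₁ ⟧ k) * δ
      ≡⟨ cong (_* δ) (dpow-merge ⟦ m₁ ⟧ p k) ⟩
    (⟦ (p ℕ.+ k) C p ⟧ * dpow ⟦ m₁ ⟧ (p ℕ.+ k)) * δ
      ≡⟨ solve 3 (λ c a d → (c :* a) :* d := c :* ((a :* d) :* con 1ℚ)) refl ⟦ (p ℕ.+ k) C p ⟧ (dpow ⟦ m₁ ⟧ (p ℕ.+ k)) δ ⟩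
    ⟦ (p ℕ.+ k) C p ⟧ * ((dpow ⟦ m₁ ⟧ (p ℕ.+ k) * δ) * 1ℚ)
      ≡⟨ cong (λ z → ⟦ (p ℕ.+ k) C p ⟧ * (z * 1ℚ)) (sym (column-dpow m₁ (p ℕ.+ k) d₁ (s₁ ∸ 1))) ⟩
    ⟦ (p ℕ.+ k) C p ⟧ * (biColumn s₁ (p ℕ.+ k) m₁ d₁ * 1ℚ)
      ≡⟨ cong (λ q → ⟦ q C p ⟧ * (biColumn s₁ q m₁ d₁ * 1ℚ)) (sym (cong (_∸ 1) (ℕP.+-suc p k))) ⟩
    ⟦ (p ℕ.+ suc k ∸ 1) C p ⟧ * (biColumn s₁ (p ℕ.+ suc k ∸ 1) m₁ d₁ * 1ℚ) ∎
  where
  open ≡-Reasoning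
  d₁ = head₀ ds
  δ = dpow ⟦ d₁ ⟧ (s₁ ∸ 1)
zeta-as-bi r [] p (s₁ ∷ []) [] ds _ _ ()
zeta-as-bi r [] p (s₁ ∷ []) (_ ∷ _ ∷ _) ds _ _ ()
zeta-as-bi r [] p [] ms ds _ () _
zeta-as-bi r [] p (_ ∷ _ ∷ _) ms ds _ () _
zeta-as-bi r (r' ∷ rs) p [] ms ds _ () _
zeta-as-bi r (r' ∷ rs) p (s₁ ∷ s) [] ds _ _ ()
zeta-as-bi r (r' ∷ rs) p (s₁ ∷ s) (_ ∷ []) ds _ _ ()
zeta-as-bi (suc k) (r' ∷ rs) p (s₁ ∷ s) (m₁ ∷ m₂ ∷ ms) ds (_ LA.∷ 1≤rs) ls lm = begin
    dpow ⟦ n₁ ⟧ p * (zetaColumn s₁ (suc k) m₁ d₁ * Z)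
      ≡⟨ cong (λ z → dpow ⟦ n₁ ⟧ p * (z * Z)) (column-dpow m₁ k d₁ (s₁ ∸ 1)) ⟩
    dpow ⟦ n₁ ⟧ p * ((dpow ⟦ m₁ ⟧ k * δ) * Z)
      ≡⟨ solve 4 (λ a b d z → a :* ((b :* d) :* z) := (a :* b) :* (d :* z)) refl (dpow ⟦ n₁ ⟧ p) (dpow ⟦ m₁ ⟧ k) δ Z ⟩
    (dpow ⟦ n₁ ⟧ p * dpow ⟦ m₁ ⟧ k) * (δ * Z)
      ≡⟨ cong (λ z → (dpow ⟦ n₁ ⟧ p * z) * (δ * Z)) expanded ⟩
    (dpow ⟦ n₁ ⟧ p * Σ[1… suc k ] f) * (δ * Z)
      ≡⟨ cong (_* (δ * Z)) (sym (Σ-*ˡ (suc k) (dpow ⟦ n₁ ⟧ p) f)) ⟩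
    Σ[1… suc k ] (λ i → dpow ⟦ n₁ ⟧ p * f i) * (δ * Z)
      ≡⟨ sym (Σ-*ʳ (suc k) (δ * Z) _) ⟩
    Σ[1… suc k ] (λ i → (dpow ⟦ n₁ ⟧ p * f i) * (δ * Z))
      ≡⟨ Σ-cong (suc k) (λ { (suc u) _ _ → sym (term u) }) ⟩
    U p (suc k ∷ r' ∷ rs) (λ b → biWeight (L.zip (s₁ ∷ s) b) (suffixSums (m₁ ∷ m₂ ∷ ms)) ds) ∎
  where
  open ≡-Reasoning
  d₁ = head₀ ds
  n₂ = head₀ (suffixSums (m₂ ∷ ms))
  n₁ = m₁ ℕ.+ n₂
  δ = dpow ⟦ d₁ ⟧ (s₁ ∸ 1)
  Z = zetaWeight (L.zip s (r' ∷ rs)) (m₂ ∷ ms) (tail₀ ds)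
  B : List ℕ → ℚ
  B b = biWeight (L.zip s b) (suffixSums (m₂ ∷ ms)) (tail₀ ds)
  f : ℕ → ℚ
  f i = sgn (suc k ∸ i) * (dpow ⟦ n₁ ⟧ (i ∸ 1) * dpow ⟦ n₂ ⟧ (suc k ∸ i))
  expanded : dpow ⟦ m₁ ⟧ k ≡ Σ[1… suc k ] f
  expanded = trans (expand-difference ⟦ m₁ ⟧ ⟦ n₂ ⟧ k)
    (cong (λ x → Σ[1… suc k ] (λ i → sgn (suc k ∸ i) * (dpow x (i ∸ 1) * dpow ⟦ n₂ ⟧ (suc k ∸ i)))) (sym (⟦⟧-+ m₁ n₂)))
  term : ∀ u →
    (sgn (k ∸ u) * ⟦ (p ℕ.+ suc u ∸ 1) C p ⟧) * U (k ∸ u) (r' ∷ rs) (λ b → biColumn s₁ (p ℕ.+ suc u ∸ 1) n₁ d₁ * B b)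
    ≡ (dpow ⟦ n₁ ⟧ p * f (suc u)) * (δ * Z)
  term u = begin
      (sg * ⟦ (p ℕ.+ suc u ∸ 1) C p ⟧) * U (k ∸ u) (r' ∷ rs) (λ b → biColumn s₁ (p ℕ.+ suc u ∸ 1) n₁ d₁ * B b)
        ≡⟨ cong (λ q → (sg * ⟦ q C p ⟧) * U (k ∸ u) (r' ∷ rs) (λ b → biColumn s₁ q n₁ d₁ * B b)) (cong (_∸ 1) (ℕP.+-suc p u)) ⟩
      (sg * C') * U (k ∸ u) (r' ∷ rs) (λ b → biColumn s₁ (p ℕ.+ u) n₁ d₁ * B b)
        ≡⟨ cong ((sg * C') *_) (U-* (r' ∷ rs) (k ∸ u) (biColumn s₁ (p ℕ.+ u) n₁ d₁) B) ⟩
      (sg * C') * (biColumn s₁ (p ℕ.+ u) n₁ d₁ * U (k ∸ u) (r' ∷ rs) B)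
        ≡⟨ cong (λ z → (sg * C') * (biColumn s₁ (p ℕ.+ u) n₁ d₁ * z))
             (sym (zeta-as-bi r' rs (k ∸ u) s (m₂ ∷ ms) (tail₀ ds) 1≤rs (ℕP.suc-injective ls) (ℕP.suc-injective lm))) ⟩
      (sg * C') * (biColumn s₁ (p ℕ.+ u) n₁ d₁ * (dpow ⟦ n₂ ⟧ (k ∸ u) * Z))
        ≡⟨ cong (λ z → (sg * C') * (z * (dpow ⟦ n₂ ⟧ (k ∸ u) * Z))) (column-dpow n₁ (p ℕ.+ u) d₁ (s₁ ∸ 1)) ⟩
      (sg * C') * ((dpow ⟦ n₁ ⟧ (p ℕ.+ u) * δ) * (dpow ⟦ n₂ ⟧ (k ∸ u) * Z))
        ≡⟨ solve 6 (λ s c a d b z → (s :* c) :* ((a :* d) :* (b :* z)) := (s :* ((c :* a) :* b)) :* (d :* z)) refl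
             sg C' (dpow ⟦ n₁ ⟧ (p ℕ.+ u)) δ (dpow ⟦ n₂ ⟧ (k ∸ u)) Z ⟩
      (sg * ((C' * dpow ⟦ n₁ ⟧ (p ℕ.+ u)) * dpow ⟦ n₂ ⟧ (k ∸ u))) * (δ * Z)
        ≡⟨ cong (λ z → (sg * (z * dpow ⟦ n₂ ⟧ (k ∸ u))) * (δ * Z)) (sym (dpow-merge ⟦ n₁ ⟧ p u)) ⟩
      (sg * ((dpow ⟦ n₁ ⟧ p * dpow ⟦ n₁ ⟧ u) * dpow ⟦ n₂ ⟧ (k ∸ u))) * (δ * Z)
        ≡⟨ cong (_* (δ * Z)) (solve 4 (λ s a b c → s :* ((a :* b) :* c) := a :* (s :* (b :* c))) refl
             sg (dpow ⟦ n₁ ⟧ p) (dpow ⟦ n₁ ⟧ u) (dpow ⟦ n₂ ⟧ (k ∸ u))) ⟩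
      (dpow ⟦ n₁ ⟧ p * f (suc u)) * (δ * Z) ∎
    where
    sg = sgn (k ∸ u)
    C' = ⟦ (p ℕ.+ u) C p ⟧

length-zip : ∀ (xs ys : List ℕ) {n} → length xs ≡ n → length ys ≡ n → length (L.zip xs ys) ≡ n
length-zip [] ys refl _ = refl
length-zip (x ∷ xs) (y ∷ ys) {suc n} p q = cong suc (length-zip xs ys (ℕP.suc-injective p) (ℕP.suc-injective q))

first-identity : ∀ (s : List ℕ) r₁ rs N → LA.All (1 ≤_) (r₁ ∷ rs) → length s ≡ suc (length rs) →
  biBracket (L.zip s (L.map (_∸ 1) (r₁ ∷ rs))) N ≡ rhs1 s (r₁ ∷ rs) N
first-identity s r₁ rs N (1≤r₁ LA.∷ 1≤rs) len-s = begin
    biAux cols (suc N) N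
      ≡⟨ biAux-biSum cols len-cols (suc N) N ⟩
    biSum L (biWeight cols) 0 (suc N) N
      ≡⟨ change-of-variables L (biWeight cols) 0 N ⟩
    zetaSum L (λ ms ds → biWeight cols (suffixSums ms) ds) 0 N
      ≡⟨ zetaSum-cong L _ _ 0 N (λ ms ds len-ms → bi-as-zeta rs r₁ s ms ds 1≤r₁ 1≤rs len-s len-ms) ⟩
    zetaSum L (λ ms ds → T r₁ rs (λ b → zetaWeight (L.zip s b) ms ds)) 0 N
      ≡⟨ sym (T-zetaSum rs r₁ L (λ b → zetaWeight (L.zip s b)) 0 N) ⟩
    T r₁ rs (λ b → zetaSum L (zetaWeight (L.zip s b)) 0 N)
      ≡⟨ T-cong rs r₁ _ _ (λ b len-b → sym (zAux-zetaSum (L.zip s b) (length-zip s b len-s len-b) 0 N)) ⟩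
    T r₁ rs (λ b → zAux (L.zip s b) 0 N) ∎
  where
  open ≡-Reasoning
  L = suc (length rs)
  cols = L.zip s (L.map (_∸ 1) (r₁ ∷ rs))
  len-cols : length cols ≡ L
  len-cols = length-zip s _ len-s (cong suc (LP.length-map (_∸ 1) rs))

-- For l ≥ 2, the right-hand side of the second identity is U with no
-- carried factor (p = 0, where C(i-1, 0) = 1).
rhs2-as-U : ∀ s r₁ r₂ rs N → rhs2 s (r₁ ∷ r₂ ∷ rs) N ≡ U 0 (r₁ ∷ r₂ ∷ rs) (λ b → biBracket (L.zip s b) N)
rhs2-as-U s r₁ r₂ rs N = Σ-cong r₁ (λ i _ _ →
  cong (_* U (r₁ ∸ i) (r₂ ∷ rs) (λ b → biBracket (L.zip s ((i ∸ 1) ∷ b)) N)) (sym (ℚP.*-identityʳ (sgn (r₁ ∸ i)))))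

second-identity : ∀ (s : List ℕ) r₁ r₂ rs N → LA.All (1 ≤_) (r₁ ∷ r₂ ∷ rs) → length s ≡ suc (suc (length rs)) →
  zetaBracket (L.zip s (r₁ ∷ r₂ ∷ rs)) N ≡ rhs2 s (r₁ ∷ r₂ ∷ rs) N
second-identity s r₁ r₂ rs N 1≤r len-s = begin
    zAux (L.zip s (r₁ ∷ r₂ ∷ rs)) 0 N
      ≡⟨ zAux-zetaSum (L.zip s (r₁ ∷ r₂ ∷ rs)) (length-zip s (r₁ ∷ r₂ ∷ rs) len-s refl) 0 N ⟩
    zetaSum L (zetaWeight (L.zip s (r₁ ∷ r₂ ∷ rs))) 0 N
      ≡⟨ zetaSum-cong L (zetaWeight (L.zip s (r₁ ∷ r₂ ∷ rs))) _ 0 N (λ ms ds len-ms →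
           trans (sym (ℚP.*-identityˡ _)) (zeta-as-bi r₁ (r₂ ∷ rs) 0 s ms ds 1≤r len-s len-ms)) ⟩
    zetaSum L (λ ms ds → U 0 (r₁ ∷ r₂ ∷ rs) (λ b → biWeight (L.zip s b) (suffixSums ms) ds)) 0 N
      ≡⟨ sym (U-zetaSum (r₁ ∷ r₂ ∷ rs) 0 L (λ b ms ds → biWeight (L.zip s b) (suffixSums ms) ds) 0 N) ⟩
    U 0 (r₁ ∷ r₂ ∷ rs) (λ b → zetaSum L (λ ms ds → biWeight (L.zip s b) (suffixSums ms) ds) 0 N)
      ≡⟨ U-cong (r₁ ∷ r₂ ∷ rs) 0 _ _ (λ b len-b →
           sym (trans (biAux-biSum (L.zip s b) (length-zip s b len-s len-b) (suc N) N) (change-of-variables L (biWeight (L.zip s b)) 0 N))) ⟩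
    U 0 (r₁ ∷ r₂ ∷ rs) (λ b → biBracket (L.zip s b) N)
      ≡⟨ sym (rhs2-as-U s r₁ r₂ rs N) ⟩
    rhs2 s (r₁ ∷ r₂ ∷ rs) N ∎
  where
  open ≡-Reasoning
  L = suc (suc (length rs))

toList-zip : ∀ {n} (xs ys : Vec ℕ n) → toList (zip xs ys) ≡ L.zip (toList xs) (toList ys)
toList-zip V.[] V.[] = refl
toList-zip (x V.∷ xs) (y V.∷ ys) = cong ((x , y) ∷_) (toList-zip xs ys)

-- The theorem: the two list identities applied to the vectors of the
-- statement.
proposition3 : (l : ℕ) → 2 ≤ l → (s r : Vec ℕ l) → All (1 ≤_) s → All (1 ≤_) r →
    ((N : ℕ) → biBracket (toList (zip s (map (_∸ 1) r))) N ≡ rhs1 (toList s) (toList r) N)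
    × ((N : ℕ) → zetaBracket (toList (zip s r)) N ≡ rhs2 (toList s) (toList r) N)
proposition3 (suc zero) (s≤s ()) s r _ _
proposition3 (suc (suc l)) _ s r@(r₁ V.∷ r₂ V.∷ r′) _ 1≤r = first , second
  where
  len-s : length (toList s) ≡ suc (suc (length (toList r′)))
  len-s = trans (VP.length-toList s) (cong (λ n → suc (suc n)) (sym (VP.length-toList r′)))
  first : ∀ N → biBracket (toList (zip s (map (_∸ 1) r))) N ≡ rhs1 (toList s) (toList r) N
  first N = trans (cong (λ cols → biBracket cols N)
                    (trans (toList-zip s (map (_∸ 1) r)) (cong (L.zip (toList s)) (VP.toList-map (_∸ 1) r))))
                  (first-identity (toList s) r₁ (r₂ ∷ toList r′) N (VAP.toList⁺ 1≤r) len-s)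
  second : ∀ N → zetaBracket (toList (zip s r)) N ≡ rhs2 (toList s) (toList r) N
  second N = trans (cong (λ cols → zetaBracket cols N) (toList-zip s r))
                   (second-identity (toList s) r₁ r₂ (toList r′) N (VAP.toList⁺ 1≤r) len-s)
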